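{- Let $G$ be a plane graph, $n$ even, and $a_1,\ldots,a_n$ distinct vertices appearing in this cyclic order on a face of $G$; let $A=\{a_1,\ldots,a_n\}=A_K\cup A_H$ be a partition into disjoint subsets, $H=G-A_K$ and $K=G-A_H$. Suppose $H$ has exactly one perfect matching $M_H$. Then the number of nests of pairwise non-intersecting $M_H$-alternating paths in $G$ with the vertices of $A$ as endpoints equals $M(K)$.
   Context: $M(\Gamma)$ is the number of perfect matchings of $\Gamma$; $G-S$ is the subgraph induced by the vertices not in $S$. An $M_H$-alternating path from $a_i$ to $a_j$ is a path in $G$ with endpoints $a_i,a_j$ in which every other edge belongs to $M_H$, and such that if $a_i\in A_H$ (resp. $a_j\in A_H$) the path contains the edge of $M_H$ incident with $a_i$ (resp. $a_j$). A nest is a collection of $M_H$-alternating paths between vertices of $A$ such that every vertex of $A$ is an endpoint of exactly one path of the collection; it is non-intersecting if its paths are pairwise vertex-disjoint. -}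

module Defs where

open import Data.Bool using (Bool; true; false; _∧_; _∨_; not; T; if_then_else_; _xor_)
open import Data.Nat using (ℕ; zero; suc; _+_; _*_; _<ᵇ_; _≡ᵇ_)
open import Data.Nat.DivMod using (_mod_)
open import Data.Fin using (Fin; zero; suc; toℕ; _≟_)
open import Data.List using (List; []; _∷_)
open import Data.Vec using (Vec; lookup)
open import Data.Maybe using (Maybe; just; nothing)
open import Data.Product using (Σ; ∃; _×_; _,_; proj₁)
open import Relation.Nullary.Decidable using (⌊_⌋)
open import Relation.Binary.PropositionalEquality using (_≡_; refl)
open import Function using (_∘_)

anyF : ∀ {n} → (Fin n → Bool) → Bool
anyF {zero} f = false
anyF {suc n} f = f zero ∨ anyF (f ∘ suc)

allF : ∀ {n} → (Fin n → Bool) → Bool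
allF {zero} f = true
allF {suc n} f = f zero ∧ allF (f ∘ suc)

countF : ∀ {n} → (Fin n → Bool) → ℕ
countF {zero} f = 0
countF {suc n} f = (if f zero then 1 else 0) + countF (f ∘ suc)

sumF : ∀ {n} → (Fin n → ℕ) → ℕ
sumF {zero} f = 0
sumF {suc n} f = f zero + sumF (f ∘ suc)

allBelow : ℕ → (ℕ → Bool) → Bool
allBelow zero p = true
allBelow (suc m) p = allBelow m p ∧ p m

_==_ : ∀ {N} → Fin N → Fin N → Bool
u == v = ⌊ u ≟ v ⌋

_<F_ : ∀ {N} → Fin N → Fin N → Bool
u <F v = toℕ u <ᵇ toℕ v

_==M_ : ∀ {N} → Maybe (Fin N) → Fin N → Bool
just u ==M v = u == v
nothing ==M v = false

iterate : ∀ {A : Set} → (A → A) → ℕ → A → A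
iterate f zero x = x
iterate f (suc k) x = f (iterate f k x)

next : ∀ {n} → Fin n → Fin n
next {suc n} i = suc (toℕ i) mod (suc n)

record Graph (N : ℕ) : Set where
  field
    adj     : Fin N → Fin N → Bool
    adj-sym : ∀ u v → adj u v ≡ adj v u
    adj-irr : ∀ v → adj v v ≡ false

Rotation : ℕ → Set
Rotation N = Fin N → Fin N → Fin N

module _ {N : ℕ} (G : Graph N) where
  open Graph G

  IsRotationSystem : Rotation N → Set
  IsRotationSystem σ =
    ∀ v u → T (adj v u) →
      T (adj v (σ v u)) × (∀ w → T (adj v w) → ∃ λ k → iterate (σ v) k u ≡ w)

  faceStep : Rotation N → Fin N × Fin N → Fin N × Fin N
  faceStep σ (u , v) = (v , σ v u)

  dartLt : Fin N × Fin N → Fin N × Fin N → Bool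
  dartLt (u , v) (u' , v') = (u <F u') ∨ ((u == u') ∧ (v <F v'))

  numDarts : ℕ
  numDarts = sumF λ u → countF λ v → adj u v

  -- a dart is the representative of its face if it is lexicographically
  -- least in its faceStep-orbit (orbits have length < N * N)
  isFaceRep : Rotation N → Fin N × Fin N → Bool
  isFaceRep σ (u , v) =
    adj u v ∧ allBelow (N * N) (λ k → not (dartLt (iterate (faceStep σ) k (u , v)) (u , v)))

  numFaces : Rotation N → ℕ
  numFaces σ = sumF λ u → countF λ v → isFaceRep σ (u , v)

  connWithin : ℕ → Fin N → Fin N → Bool
  connWithin zero u v = u == v
  connWithin (suc k) u v = connWithin k u v ∨ anyF (λ w → connWithin k u w ∧ adj w v)

  numComponents : ℕ
  numComponents = countF λ v → allF λ w → not (connWithin N w v ∧ (w <F v))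

  numIsolated : ℕ
  numIsolated = countF λ v → not (anyF (adj v))

  -- Euler's formula V - E + F = 2 on every component with an edge
  -- (isolated vertices have no darts/faces), i.e. the embedding has genus 0:
  -- summed: 2V + 2I + 2F = 4C + D  (D = number of darts = 2E).
  IsPlanar : Rotation N → Set
  IsPlanar σ = 2 * N + 2 * numIsolated + 2 * numFaces σ ≡ 4 * numComponents + numDarts

module _ {N n : ℕ} (G : Graph N) (a : Fin n → Fin N) where
  open Graph G

  inA : Fin N → Bool
  inA x = anyF λ i → a i == x

  apexAdj : Fin (suc N) → Fin (suc N) → Bool
  apexAdj zero zero = false
  apexAdj zero (suc x) = inA x
  apexAdj (suc x) zero = inA x
  apexAdj (suc x) (suc y) = adj x y

  apexSym : ∀ u v → apexAdj u v ≡ apexAdj v u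
  apexSym zero zero = refl
  apexSym zero (suc y) = refl
  apexSym (suc x) zero = refl
  apexSym (suc x) (suc y) = adj-sym x y

  apexIrr : ∀ v → apexAdj v v ≡ false
  apexIrr zero = refl
  apexIrr (suc x) = adj-irr x

  withApex : Graph (suc N)
  withApex = record { adj = apexAdj ; adj-sym = apexSym ; adj-irr = apexIrr }

  -- "G is a plane graph and a_1,…,a_n appear in this cyclic order on a face":
  -- G admits a genus-0 combinatorial embedding in which a new vertex z can be
  -- placed inside the face, joined to a_1,…,a_n, with rotation (a_1 … a_n) at z.
  PlaneWithFaceOrder : Set
  PlaneWithFaceOrder =
    Σ (Rotation (suc N)) λ σ →
      IsRotationSystem withApex σ × IsPlanar withApex σ ×
      (∀ i → σ zero (suc (a i)) ≡ suc (a (next i)))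

-- Perfect matchings of induced subgraphs G[S], encoded by partner vectors

module _ {N : ℕ} (G : Graph N) where
  open Graph G

  matchOK : (Fin N → Bool) → Vec (Maybe (Fin N)) N → Fin N → Maybe (Fin N) → Bool
  matchOK S p v nothing = not (S v)
  matchOK S p v (just u) = S v ∧ S u ∧ adj v u ∧ (lookup p u ==M v)

  isPerfectMatching : (Fin N → Bool) → Vec (Maybe (Fin N)) N → Bool
  isPerfectMatching S p = allF λ v → matchOK S p v (lookup p v)

  PerfectMatching : (Fin N → Bool) → Set
  PerfectMatching S = Σ (Vec (Maybe (Fin N)) N) λ p → T (isPerfectMatching S p)

-- The setting: A = {a_i}, A_K = {a_i | inK i}, A_H = {a_i | not (inK i)}

module _ {N n : ℕ} (a : Fin n → Fin N) (inK : Fin n → Bool) where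

  inAK : Fin N → Bool
  inAK v = anyF λ i → (a i == v) ∧ inK i

  inAH : Fin N → Bool
  inAH v = anyF λ i → (a i == v) ∧ not (inK i)

  vertsH : Fin N → Bool
  vertsH v = not (inAK v)

  vertsK : Fin N → Bool
  vertsK v = not (inAH v)

module _ {N n : ℕ} (G : Graph N) (a : Fin n → Fin N) (inK : Fin n → Bool)
         (MH : PerfectMatching G (vertsH a inK)) where
  open Graph G

  pH : Vec (Maybe (Fin N)) N
  pH = proj₁ MH

  inMH : Fin N → Fin N → Bool
  inMH u v = lookup pH u ==M v

  elem : Fin N → List (Fin N) → Bool
  elem x [] = false
  elem x (y ∷ ys) = (x == y) ∨ elem x ys

  distinctL : List (Fin N) → Bool
  distinctL [] = true
  distinctL (x ∷ xs) = not (elem x xs) ∧ distinctL xs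

  consecAdj : List (Fin N) → Bool
  consecAdj (x ∷ y ∷ rest) = adj x y ∧ consecAdj (y ∷ rest)
  consecAdj _ = true

  alternates : List (Fin N) → Bool
  alternates (x ∷ y ∷ z ∷ rest) = (inMH x y xor inMH y z) ∧ alternates (y ∷ z ∷ rest)
  alternates _ = true

  containsEdge : Fin N → Fin N → List (Fin N) → Bool
  containsEdge u v (x ∷ y ∷ rest) =
    ((x == u) ∧ (y == v)) ∨ ((x == v) ∧ (y == u)) ∨ containsEdge u v (y ∷ rest)
  containsEdge u v _ = false

  startsAt : Fin N → List (Fin N) → Bool
  startsAt x [] = false
  startsAt x (y ∷ _) = x == y

  endsAt : Fin N → List (Fin N) → Bool
  endsAt x [] = false
  endsAt x (y ∷ []) = x == y
  endsAt x (_ ∷ y ∷ ys) = endsAt x (y ∷ ys)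

  isEmpty : List (Fin N) → Bool
  isEmpty [] = true
  isEmpty (_ ∷ _) = false

  endCond : Fin N → List (Fin N) → Bool
  endCond x vs with lookup pH x
  ... | just y  = not (inAH a inK x) ∨ containsEdge x y vs
  ... | nothing = not (inAH a inK x)

  isAltPath : Fin N → Fin N → List (Fin N) → Bool
  isAltPath x y vs =
    startsAt x vs ∧ endsAt y vs ∧ distinctL vs ∧ consecAdj vs ∧ alternates vs
      ∧ endCond x vs ∧ endCond y vs

  disjointL : List (Fin N) → List (Fin N) → Bool
  disjointL [] ys = true
  disjointL (x ∷ xs) ys = not (elem x ys) ∧ disjointL xs ys

  -- A nest is encoded as ν : Vec (List (Fin N)) n where, for each path of the
  -- nest joining a_i and a_j with i < j, ν i is that path traversed from a_i to
  -- a_j, and ν k = [] when a_k is not the lower-indexed endpoint of its path.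
  module _ (ν : Vec (List (Fin N)) n) where
    entryOK : Fin n → Bool
    entryOK i = isEmpty (lookup ν i)
      ∨ anyF (λ j → (i <F j) ∧ isAltPath (a i) (a j) (lookup ν i))

    endpointOf : Fin n → Fin n → Bool
    endpointOf k i = not (isEmpty (lookup ν i)) ∧ ((i == k) ∨ endsAt (a k) (lookup ν i))

    isNest : Bool
    isNest = allF entryOK ∧ allF (λ k → countF (endpointOf k) ≡ᵇ 1)

    nonIntersecting : Bool
    nonIntersecting = allF λ i → allF λ j → (i == j) ∨ disjointL (lookup ν i) (lookup ν j)

  NonIntersectingNest : Set
  NonIntersectingNest = Σ (Vec (List (Fin N)) n) λ ν → T (isNest ν ∧ nonIntersecting ν)

{-# OPTIONS --safe #-}
module Submission where

-- Let M_K be a perfect matching of K.  In the multigraph M_H ∪ M_K every vertex of A has degree one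
-- (A_K is covered only by M_K, A_H only by M_H) and every other vertex degree two, so
-- walking from a_k alternately along M_H and M_K is forced and ends at another vertex of
-- A.  These walks are M_H-alternating, pairwise disjoint and pair up A: they form a nest.
-- Conversely, switching M_H along the paths of a nest gives a perfect matching of K.  The
-- maps are mutually inverse since the walks of the switched matching retrace the nest, and
-- since off its walks M_K agrees with M_H: replacing M_K by M_H on the walks yields a
-- perfect matching of H, which is M_H by uniqueness (this excludes alternating cycles).

open import Defs
open import Data.Bool using (Bool; true; false; _∧_; _∨_; _xor_; not; T; if_then_else_)
open import Data.Bool.Properties using (T-∧; T-∨; T-≡; T-not-≡; T-irrelevant; not-involutive; not-¬)
open import Data.Fin using (Fin; zero; suc; toℕ; _≟_)
open import Data.Fin.Properties using (any?; injective⇒≤; suc-injective; toℕ-injective)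
open import Data.List using (List; []; _∷_; [_]; _++_; length; reverse)
import Data.List as List
open import Data.List.Properties using (length-++; unfold-reverse)
open import Data.List.Membership.Propositional using (_∈_; _∉_)
open import Data.List.Membership.Propositional.Properties using (∈-lookup)
open import Data.List.Relation.Binary.Disjoint.Propositional using (Disjoint)
open import Data.List.Relation.Unary.All using ([]; _∷_)
import Data.List.Relation.Unary.All as All
open import Data.List.Relation.Unary.All.Properties using (¬Any⇒All¬)
open import Data.List.Relation.Unary.Any using (here; there)
open import Data.List.Relation.Unary.Any.Properties using (reverse⁺)
open import Data.List.Relation.Unary.Unique.Propositional using (Unique; []; _∷_)
import Data.List.Relation.Unary.Unique.Propositional.Properties as Unique
open import Data.Maybe using (Maybe; just; nothing)
open import Data.Maybe.Properties using (just-injective)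
open import Data.Nat using (ℕ; zero; suc; _+_; _≤_; _<_; _≡ᵇ_)
open import Data.Nat.Divisibility using (_∣_)
open import Data.Nat.Properties using (n<1+n; +-identityʳ; +-assoc; <⇒≱)
import Data.Nat.Properties as ℕ
open import Data.Product using (Σ; ∃; _×_; _,_; proj₁; proj₂)
import Data.Product as Product
open import Data.Sum using (_⊎_; inj₁; inj₂; [_,_]′)
import Data.Sum as Sum
open import Data.Vec using (Vec; lookup; tabulate)
open import Data.Vec.Properties using (lookup∘tabulate; tabulate-cong; tabulate∘lookup)
open import Function using (_∘_; _⇔_; case_of_)
open import Function.Bundles using (Equivalence; mk⇔; _↔_; mk↔ₛ′)
open import Relation.Binary.Definitions using (tri<; tri≈; tri>)
open import Relation.Binary.PropositionalEquality
  using (_≡_; _≢_; refl; sym; trans; cong; subst; subst₂; module ≡-Reasoning)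
open import Relation.Nullary using (¬_; contradiction; yes; no; Dec)
open import Relation.Nullary.Decidable using (toWitness; fromWitness; toSum; dec-true; dec-false)
open import Relation.Nullary.Decidable.Core using (does)

T-∧⁺ : ∀ {x y} → T x → T y → T (x ∧ y)
T-∧⁺ p q = Equivalence.from T-∧ (p , q)

T-∧⁻ : ∀ {x y} → T (x ∧ y) → T x × T y
T-∧⁻ = Equivalence.to T-∧

T-∨⁻ : ∀ {x y} → T (x ∨ y) → T x ⊎ T y
T-∨⁻ = Equivalence.to T-∨

T-∨⁺ˡ : ∀ {x y} → T x → T (x ∨ y)
T-∨⁺ˡ = Equivalence.from T-∨ ∘ inj₁

T-∨⁺ʳ : ∀ {x y} → T y → T (x ∨ y)
T-∨⁺ʳ = Equivalence.from T-∨ ∘ inj₂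

T-not⁺ : ∀ {x} → ¬ T x → T (not x)
T-not⁺ {false} _ = _
T-not⁺ {true} ¬x = ¬x _

T-not⁻ : ∀ {x} → T (not x) → ¬ T x
T-not⁻ {false} _ ()

same-or-flipped : ∀ s t → s ≡ t ⊎ s ≡ not t
same-or-flipped false false = inj₁ refl
same-or-flipped false true = inj₂ refl
same-or-flipped true false = inj₂ refl
same-or-flipped true true = inj₁ refl

==⇒≡ : ∀ {N} {u v : Fin N} → T (u == v) → u ≡ v
==⇒≡ = toWitness

≡⇒== : ∀ {N} {u v : Fin N} → u ≡ v → T (u == v)
≡⇒== = fromWitness

==-refl : ∀ {N} (u : Fin N) → T (u == u)
==-refl u = ≡⇒== {u = u} refl

≢⇒==-false : ∀ {N} {u v : Fin N} → u ≢ v → (u == v) ≡ false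
≢⇒==-false {u = u} {v} u≢v with u ≟ v
... | yes u≡v = contradiction u≡v u≢v
... | no _ = refl

<F-asym : ∀ {n} {i j : Fin n} → T (i <F j) → ¬ T (j <F i)
<F-asym {i = i} {j} i<j j<i = ℕ.<-asym (ℕ.<ᵇ⇒< (toℕ i) (toℕ j) i<j) (ℕ.<ᵇ⇒< (toℕ j) (toℕ i) j<i)

<F-irrefl : ∀ {n} {i : Fin n} → ¬ T (i <F i)
<F-irrefl {i = i} i<i = <F-asym {i = i} i<i i<i

<F-connex : ∀ {n} {i j : Fin n} → i ≢ j → ¬ T (i <F j) → T (j <F i)
<F-connex {i = i} {j} i≢j i≮j with ℕ.<-cmp (toℕ i) (toℕ j)
... | tri< i<j _ _ = contradiction (ℕ.<⇒<ᵇ i<j) i≮j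
... | tri≈ _ i≡j _ = contradiction (toℕ-injective i≡j) i≢j
... | tri> _ _ j<i = ℕ.<⇒<ᵇ j<i

allF⁻ : ∀ {n} {f : Fin n → Bool} → T (allF f) → ∀ i → T (f i)
allF⁻ {suc n} p zero = proj₁ (T-∧⁻ p)
allF⁻ {suc n} p (suc i) = allF⁻ (proj₂ (T-∧⁻ p)) i

allF⁺ : ∀ {n} {f : Fin n → Bool} → (∀ i → T (f i)) → T (allF f)
allF⁺ {zero} _ = _
allF⁺ {suc n} p = T-∧⁺ (p zero) (allF⁺ (p ∘ suc))

anyF⁻ : ∀ {n} {f : Fin n → Bool} → T (anyF f) → ∃ λ i → T (f i)
anyF⁻ {suc n} p with T-∨⁻ p
... | inj₁ p₀ = zero , p₀
... | inj₂ pₛ with anyF⁻ pₛ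
...   | i , q = suc i , q

anyF⁺ : ∀ {n} {f : Fin n → Bool} i → T (f i) → T (anyF f)
anyF⁺ zero p = T-∨⁺ˡ p
anyF⁺ (suc i) p = T-∨⁺ʳ (anyF⁺ i p)

countF-none : ∀ {n} {f : Fin n → Bool} → (∀ i → ¬ T (f i)) → countF f ≡ 0
countF-none {zero} _ = refl
countF-none {suc n} {f} none with f zero in f₀
... | true = contradiction (subst T (sym f₀) _) (none zero)
... | false = countF-none (none ∘ suc)

countF-one : ∀ {n} {f : Fin n → Bool} i → T (f i) → (∀ j → T (f j) → j ≡ i) → T (countF f ≡ᵇ 1)
countF-one {suc n} {f} zero fi only with f zero
... | true rewrite countF-none {f = f ∘ suc} (λ j fj → contradiction (only (suc j) fj) λ ()) = _
countF-one {suc n} {f} (suc i) fi only with f zero in f₀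
... | true = contradiction (only zero (subst T (sym f₀) _)) λ ()
... | false = countF-one i fi (λ j fj → suc-injective (only (suc j) fj))

countF-one⁻ : ∀ {n} {f : Fin n → Bool} → T (countF f ≡ᵇ 1) → ∃ λ i → T (f i)
countF-one⁻ {suc n} {f} c with f zero in f₀
... | true = zero , subst T (sym f₀) _
... | false with countF-one⁻ c
...   | i , fi = suc i , fi

module _ {A : Set} where

  unique-head∉ : ∀ {x : A} {xs} → Unique (x ∷ xs) → x ∉ xs
  unique-head∉ = Unique.Unique[x∷xs]⇒x∉xs

  unique-tail : ∀ {x : A} {xs} → Unique (x ∷ xs) → Unique xs
  unique-tail (_ ∷ u) = u

  unique-cons : ∀ {x : A} {xs} → x ∉ xs → Unique xs → Unique (x ∷ xs)
  unique-cons x∉ u = ¬Any⇒All¬ _ x∉ ∷ u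

  unique-snoc : ∀ {x : A} {xs} → Unique xs → x ∉ xs → Unique (xs ++ [ x ])
  unique-snoc u x∉ = Unique.++⁺ u (unique-cons (λ ()) []) λ where (x∈ , here refl) → x∉ x∈

  ∈⇒nonempty : ∀ {x : A} {xs} → x ∈ xs → xs ≢ []
  ∈⇒nonempty (here _) ()
  ∈⇒nonempty (there _) ()

  unique-lookup-injective : ∀ {xs : List A} → Unique xs
                          → ∀ {i j} → List.lookup xs i ≡ List.lookup xs j → i ≡ j
  unique-lookup-injective (_ ∷ _) {zero} {zero} _ = refl
  unique-lookup-injective (x≢ ∷ _) {zero} {suc j} x≡ = contradiction x≡ (All.lookup x≢ (∈-lookup j))
  unique-lookup-injective (x≢ ∷ _) {suc i} {zero} ≡x = contradiction (sym ≡x) (All.lookup x≢ (∈-lookup i))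
  unique-lookup-injective (_ ∷ u) {suc i} {suc j} e = cong suc (unique-lookup-injective u e)

unique-length≤ : ∀ {N} {xs : List (Fin N)} → Unique xs → length xs ≤ N
unique-length≤ u = injective⇒≤ (unique-lookup-injective u)

-- Alternating trails and walks

module Trails {N : ℕ} (R : Bool → Fin N → Fin N → Set) where

  infixr 5 _▸_

  -- Trail t v xs w te: the vertex list xs is a walk from v to w whose edges
  -- satisfy R with alternating colours, the first edge having colour t; te is
  -- the colour an edge leaving w would need to continue the alternation.
  data Trail : Bool → Fin N → List (Fin N) → Fin N → Bool → Set where
    nil : ∀ {t v} → Trail t v [ v ] v t
    _▸_ : ∀ {t v u xs w te} → R t v u → Trail (not t) u (u ∷ xs) w te → Trail t v (v ∷ u ∷ xs) w te

  head∈ : ∀ {t v xs w te} → Trail t v xs w te → v ∈ xs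
  head∈ nil = here refl
  head∈ (_ ▸ _) = here refl

  last∈ : ∀ {t v xs w te} → Trail t v xs w te → w ∈ xs
  last∈ nil = here refl
  last∈ (_ ▸ p) = there (last∈ p)

  last-unique : ∀ {t v xs w te t′ v′ w′ te′} → Trail t v xs w te → Trail t′ v′ xs w′ te′
              → w ≡ w′
  last-unique nil nil = refl
  last-unique (_ ▸ p) (_ ▸ q) = last-unique p q

  closed-trail-trivial : ∀ {t v xs te} → Trail t v xs v te → Unique xs → te ≡ t
  closed-trail-trivial nil _ = refl
  closed-trail-trivial (_ ▸ p) u = contradiction (last∈ p) (unique-head∉ u)

  snoc : ∀ {t v xs w te u} → Trail t v xs w te → R te w u → Trail t v (xs ++ [ u ]) u (not te)
  snoc nil r = r ▸ nil
  snoc (s ▸ p) r = s ▸ snoc p r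

  module _ (R-sym : ∀ {t x y} → R t x y → R t y x) where

    reverse-trail : ∀ {t v xs w te} → Trail t v xs w te → Trail (not te) w (reverse xs) v (not t)
    reverse-trail nil = nil
    reverse-trail {t} {v} {v ∷ xs} (s ▸ p) rewrite unfold-reverse v xs =
      subst (Trail _ _ _ v) (not-involutive (not t))
        (snoc (reverse-trail p) (subst (λ c → R c _ v) (sym (not-involutive t)) (R-sym s)))

open Trails public using (nil; _▸_)

module AlternatingWalks {N : ℕ} (P : Bool → Fin N → Maybe (Fin N))
  (P-involutive : ∀ {t x y} → P t x ≡ just y → P t y ≡ just x)
  (P-irreflexive : ∀ {t x} → P t x ≢ just x) where

  Step : Bool → Fin N → Fin N → Set
  Step t x y = P t x ≡ just y

  open Trails Step public hiding (nil; _▸_)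

  nothing≢just : ∀ {x : Fin N} → nothing ≢ just x
  nothing≢just ()

  record MaximalWalk (t : Bool) (v : Fin N) (xs : List (Fin N)) : Set where
    constructor maximal
    field
      {end} : Fin N
      {endColour} : Bool
      trail : Trail t v xs end endColour
      stops : P endColour end ≡ nothing

  stopping-trails-deterministic : ∀ {t v xs ys w te w′ te′} → Trail t v xs w te → P te w ≡ nothing
                                → Trail t v ys w′ te′ → P te′ w′ ≡ nothing → xs ≡ ys
  stopping-trails-deterministic nil _ nil _ = refl
  stopping-trails-deterministic nil s (e ▸ _) _ = contradiction (trans (sym s) e) nothing≢just
  stopping-trails-deterministic (e ▸ _) _ nil s = contradiction (trans (sym s) e) nothing≢just
  stopping-trails-deterministic {v = v} (e ▸ p) s (e′ ▸ p′) s′ with just-injective (trans (sym e) e′)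
  ... | refl = cong (v ∷_) (stopping-trails-deterministic p s p′ s′)

  maximal-walk-deterministic : ∀ {t v xs ys} → MaximalWalk t v xs → MaximalWalk t v ys → xs ≡ ys
  maximal-walk-deterministic (maximal p s) (maximal p′ s′) = stopping-trails-deterministic p s p′ s′

  next-returns-to-start : ∀ {t v xs w te u} → Trail t v xs w te → Unique xs → P te w ≡ just u → u ∈ xs
                        → u ≡ v × te ≡ not t
  next-returns-to-start nil _ e (here refl) = contradiction e P-irreflexive
  next-returns-to-start {t} {te = te} (s ▸ p) uniq e (here refl) with same-or-flipped te t
  ... | inj₂ te≡¬t = refl , te≡¬t
  ... | inj₁ refl with just-injective (trans (sym s) (P-involutive e))
  ...   | refl = contradiction (closed-trail-trivial p (unique-tail uniq)) (not-¬ refl)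
  next-returns-to-start {t} (s ▸ p) uniq e (there u∈) with next-returns-to-start p (unique-tail uniq) e u∈
  ... | refl , refl with just-injective (trans (sym (P-involutive s))
                                               (P-involutive (subst (λ c → P c _ ≡ _) (not-involutive t) e)))
  ...   | refl = contradiction (last∈ p) (unique-head∉ uniq)

  module _ {t : Bool} {v : Fin N} (start : P (not t) v ≡ nothing) where

    next-fresh : ∀ {xs w te u} → Trail t v xs w te → Unique xs → P te w ≡ just u → u ∉ xs
    next-fresh p uniq e u∈ with next-returns-to-start p uniq e u∈
    ... | refl , refl = contradiction (trans (sym start) (P-involutive e)) nothing≢just

    -- The fuel cannot run out: a trail without repeated vertices has at most N of them.
    extend : ∀ fuel {xs w te} → Trail t v xs w te → Unique xs → N < length xs + fuel
           → ∃ λ ys → MaximalWalk t v ys × Unique ys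
    extend zero _ uniq bound = contradiction (unique-length≤ uniq) (<⇒≱ (subst (N <_) (+-identityʳ _) bound))
    extend (suc fuel) {xs} {w} {te} p uniq bound with P te w in e
    ... | nothing = xs , maximal p e , uniq
    ... | just u = extend fuel (snoc p e) (unique-snoc uniq (next-fresh p uniq e))
                     (subst (N <_) (sym (trans (cong (_+ fuel) (length-++ xs)) (+-assoc (length xs) 1 fuel))) bound)

    maximal-walk-exists : ∃ λ xs → MaximalWalk t v xs × Unique xs
    maximal-walk-exists = extend N nil ([] ∷ []) (n<1+n N)

  neighbour∈ : ∀ {t v xs w te x s y} → Trail t v xs w te → x ∈ xs → P s x ≡ just y
             → y ∈ xs ⊎ (x ≡ v × s ≡ not t) ⊎ (x ≡ w × s ≡ te)
  neighbour∈ {t} {s = s} nil (here refl) e with same-or-flipped s t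
  ... | inj₁ s≡t = inj₂ (inj₂ (refl , s≡t))
  ... | inj₂ s≡¬t = inj₂ (inj₁ (refl , s≡¬t))
  neighbour∈ {t} {s = s} (st ▸ p) (here refl) e with same-or-flipped s t
  ... | inj₁ refl = inj₁ (there (subst (_∈ _) (just-injective (trans (sym st) e)) (head∈ p)))
  ... | inj₂ s≡¬t = inj₂ (inj₁ (refl , s≡¬t))
  neighbour∈ {t} (st ▸ p) (there x∈) e with neighbour∈ p x∈ e
  ... | inj₁ y∈ = inj₁ (there y∈)
  ... | inj₂ (inj₂ at-end) = inj₂ (inj₂ at-end)
  ... | inj₂ (inj₁ (refl , refl)) =
    inj₁ (here (just-injective (trans (sym (subst (λ c → P c _ ≡ _) (not-involutive t) e)) (P-involutive st))))

  maximal-walk-closed : ∀ {t v xs x s y} → P (not t) v ≡ nothing → MaximalWalk t v xs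
                      → x ∈ xs → P s x ≡ just y → y ∈ xs
  maximal-walk-closed start (maximal p stop) x∈ e with neighbour∈ p x∈ e
  ... | inj₁ y∈ = y∈
  ... | inj₂ (inj₁ (refl , refl)) = contradiction (trans (sym start) e) nothing≢just
  ... | inj₂ (inj₂ (refl , refl)) = contradiction (trans (sym stop) e) nothing≢just

  trail-start-in-closed-set : (S : Fin N → Set) → (∀ {s x y} → S x → P s x ≡ just y → S y)
                            → ∀ {t v xs w te x} → Trail t v xs w te → x ∈ xs → S x → S v
  trail-start-in-closed-set S closed nil (here refl) sx = sx
  trail-start-in-closed-set S closed (_ ▸ _) (here refl) sx = sx
  trail-start-in-closed-set S closed (st ▸ p) (there x∈) sx =
    closed (trail-start-in-closed-set S closed p x∈ sx) (P-involutive st)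

  colourless-second-vertex⇒last : ∀ {t v u xs w te s} → P t v ≡ just u → Trail (not t) u xs w te
                                → P s u ≡ nothing → u ≡ w
  colourless-second-vertex⇒last st nil e = refl
  colourless-second-vertex⇒last {t} {s = s} st (st′ ▸ _) e with same-or-flipped s t
  ... | inj₁ refl = contradiction (trans (sym e) (P-involutive st)) nothing≢just
  ... | inj₂ refl = contradiction (trans (sym e) st′) nothing≢just

  colourless⇒endpoint : ∀ {t v xs w te x s} → Trail t v xs w te → x ∈ xs → P s x ≡ nothing
                      → x ≡ v ⊎ x ≡ w
  colourless⇒endpoint nil (here refl) _ = inj₁ refl
  colourless⇒endpoint (_ ▸ _) (here refl) _ = inj₁ refl
  colourless⇒endpoint (st ▸ p) (there x∈) e with colourless⇒endpoint p x∈ e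
  ... | inj₁ refl = inj₂ (colourless-second-vertex⇒last st p e)
  ... | inj₂ x≡w = inj₂ x≡w

  maximal-walks-meet : ∀ {t v xs t′ v′ ys x} → P (not t) v ≡ nothing → (W : MaximalWalk t v xs)
                     → P (not t′) v′ ≡ nothing → MaximalWalk t′ v′ ys → x ∈ xs → x ∈ ys
                     → v′ ≡ v ⊎ v′ ≡ MaximalWalk.end W
  maximal-walks-meet {xs = xs} {v′ = v′} start W start′ W′ x∈xs x∈ys =
    colourless⇒endpoint (MaximalWalk.trail W) v′∈xs start′
    where
      v′∈xs : v′ ∈ xs
      v′∈xs = trail-start-in-closed-set (_∈ _) (maximal-walk-closed start W) (MaximalWalk.trail W′) x∈ys x∈xs

==M⇒≡just : ∀ {N} {μ : Maybe (Fin N)} {v} → T (μ ==M v) → μ ≡ just v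
==M⇒≡just {μ = just u} e = cong just (==⇒≡ e)

≡just⇒==M : ∀ {N} {μ : Maybe (Fin N)} {v} → μ ≡ just v → T (μ ==M v)
≡just⇒==M refl = ≡⇒== refl

module _ {N : ℕ} (G : Graph N) where
  open Graph G

  record IsPerfectMatchingOf (S : Fin N → Bool) (μ : Fin N → Maybe (Fin N)) : Set where
    field
      covers     : ∀ {v} → T (S v) → ∃ λ u → μ v ≡ just u
      within     : ∀ {v u} → μ v ≡ just u → T (S v)
      edge       : ∀ {v u} → μ v ≡ just u → T (adj v u)
      involutive : ∀ {v u} → μ v ≡ just u → μ u ≡ just v

    irreflexive : ∀ {v} → μ v ≢ just v
    irreflexive {v} μv≡v = subst T (adj-irr v) (edge μv≡v)

  isPerfectMatching⁻ : ∀ {S p} → T (isPerfectMatching G S p) → IsPerfectMatchingOf S (lookup p)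
  isPerfectMatching⁻ {S} {p} ok = record
    { covers = covers ; within = proj₁ ∘ matched ; edge = proj₁ ∘ proj₂ ∘ proj₂ ∘ matched
    ; involutive = ==M⇒≡just ∘ proj₂ ∘ proj₂ ∘ proj₂ ∘ matched }
    where
      at : ∀ v → T (matchOK G S p v (lookup p v))
      at = allF⁻ ok
      matched : ∀ {v u} → lookup p v ≡ just u → T (S v) × T (S u) × T (adj v u) × T (lookup p u ==M v)
      matched {v} e with T-∧⁻ (subst (T ∘ matchOK G S p v) e (at v))
      ... | sv , rest with T-∧⁻ rest
      ...   | su , rest′ with T-∧⁻ rest′
      ...     | uv , back = sv , su , uv , back
      covers : ∀ {v} → T (S v) → ∃ λ u → lookup p v ≡ just u
      covers {v} sv with lookup p v in e
      ... | just u = u , refl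
      ... | nothing = contradiction sv (T-not⁻ (subst (T ∘ matchOK G S p v) e (at v)))

  isPerfectMatching⁺ : ∀ {S μ} → IsPerfectMatchingOf S μ → T (isPerfectMatching G S (tabulate μ))
  isPerfectMatching⁺ {S} {μ} M = allF⁺ at
    where
      open IsPerfectMatchingOf M
      at : ∀ v → T (matchOK G S (tabulate μ) v (lookup (tabulate μ) v))
      at v rewrite lookup∘tabulate μ v with μ v in e
      ... | nothing = T-not⁺ λ sv → case covers sv of λ where (u , e′) → contradiction (trans (sym e) e′) λ ()
      ... | just u rewrite lookup∘tabulate μ u =
        T-∧⁺ (within e) (T-∧⁺ (within (involutive e)) (T-∧⁺ (edge e) (≡just⇒==M (involutive e))))

  perfectMatching : ∀ {S μ} → IsPerfectMatchingOf S μ → PerfectMatching G S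
  perfectMatching {μ = μ} M = tabulate μ , isPerfectMatching⁺ M

module Correspondence {N n : ℕ} (G : Graph N) (a : Fin n → Fin N) (inK : Fin n → Bool)
  (a-injective : ∀ i j → a i ≡ a j → i ≡ j) (MH : PerfectMatching G (vertsH a inK)) where

  open Graph G

  h : Fin N → Maybe (Fin N)
  h = lookup (proj₁ MH)

  h-matching : IsPerfectMatchingOf G (vertsH a inK) h
  h-matching = isPerfectMatching⁻ G {p = proj₁ MH} (proj₂ MH)

  module MH = IsPerfectMatchingOf h-matching

  -- By definition inAK a inK = inA[ inK ] and inAH a inK = inA[ not ∘ inK ].
  inA[_] : (Fin n → Bool) → Fin N → Bool
  inA[ p ] v = anyF λ i → (a i == v) ∧ p i

  module _ {p : Fin n → Bool} where

    inA⁻ : ∀ {x} → T (inA[ p ] x) → ∃ λ k → a k ≡ x × T (p k)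
    inA⁻ t with anyF⁻ t
    ... | k , q = k , ==⇒≡ (proj₁ (T-∧⁻ q)) , proj₂ (T-∧⁻ q)

    inA⁺ : ∀ {k} → T (p k) → T (inA[ p ] (a k))
    inA⁺ {k} t = anyF⁺ k (T-∧⁺ (==-refl (a k)) t)

    a∈A⁻ : ∀ {k} → T (inA[ p ] (a k)) → T (p k)
    a∈A⁻ {k} t with inA⁻ t
    ... | j , aj≡ak , pj rewrite a-injective j k aj≡ak = pj

    module Unmatched {μ : Fin N → Maybe (Fin N)} (M : IsPerfectMatchingOf G (not ∘ inA[ p ]) μ) where
      open IsPerfectMatchingOf M

      unmatched⇒a : ∀ {x} → μ x ≡ nothing → ∃ λ k → a k ≡ x × T (p k)
      unmatched⇒a {x} e with inA[ p ] x in ax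
      ... | true = inA⁻ (subst T (sym ax) _)
      ... | false = case covers (subst (T ∘ not) (sym ax) _) of λ where
        (_ , e′) → contradiction (trans (sym e) e′) λ ()

      unmatched-at-a : ∀ {k} → T (p k) → μ (a k) ≡ nothing
      unmatched-at-a {k} pk with μ (a k) in e
      ... | nothing = refl
      ... | just _ = contradiction (inA⁺ pk) (T-not⁻ (within e))

  open Unmatched {inK} h-matching public
    renaming (unmatched⇒a to h-unmatched⇒AK; unmatched-at-a to h-unmatched-at-AK)

  MHedge : Fin N → Fin N → Bool
  MHedge = inMH G a inK MH

  MHedge⇒h : ∀ {x y} → MHedge x y ≡ true → h x ≡ just y
  MHedge⇒h = ==M⇒≡just ∘ Equivalence.from T-≡

  h⇒MHedge : ∀ {x y} → h x ≡ just y → MHedge x y ≡ true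
  h⇒MHedge = Equivalence.to T-≡ ∘ ≡just⇒==M

  ¬h⇒¬MHedge : ∀ {x y} → h x ≢ just y → MHedge x y ≡ false
  ¬h⇒¬MHedge {x} {y} ne with MHedge x y in e
  ... | false = refl
  ... | true = contradiction (MHedge⇒h e) ne

  pathPartner : List (Fin N) → Fin N → Maybe (Fin N)
  pathPartner (x ∷ y ∷ rest) v =
    if MHedge x y then pathPartner (y ∷ rest) v
    else (if x == v then just y else if y == v then just x else pathPartner (y ∷ rest) v)
  pathPartner _ v = nothing

  module _ {x y : Fin N} {rest : List (Fin N)} where

    pathPartner-skip : ∀ {v} → MHedge x y ≡ true → pathPartner (x ∷ y ∷ rest) v ≡ pathPartner (y ∷ rest) v
    pathPartner-skip e rewrite e = refl

    pathPartner-first : MHedge x y ≡ false → pathPartner (x ∷ y ∷ rest) x ≡ just y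
    pathPartner-first e rewrite e with x ≟ x
    ... | yes _ = refl
    ... | no x≢x = contradiction refl x≢x

    pathPartner-second : MHedge x y ≡ false → x ≢ y → pathPartner (x ∷ y ∷ rest) y ≡ just x
    pathPartner-second e x≢y rewrite e | ≢⇒==-false x≢y with y ≟ y
    ... | yes _ = refl
    ... | no y≢y = contradiction refl y≢y

    pathPartner-other : ∀ {v} → x ≢ v → y ≢ v → pathPartner (x ∷ y ∷ rest) v ≡ pathPartner (y ∷ rest) v
    pathPartner-other x≢v y≢v rewrite ≢⇒==-false x≢v | ≢⇒==-false y≢v with MHedge x y
    ... | true = refl
    ... | false = refl

    pathPartner-cases : ∀ {v u} → pathPartner (x ∷ y ∷ rest) v ≡ just u
                      → MHedge x y ≡ false × (x ≡ v × u ≡ y ⊎ y ≡ v × u ≡ x)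
                      ⊎ pathPartner (y ∷ rest) v ≡ just u
    pathPartner-cases {v} e with MHedge x y in mh
    ... | true = inj₂ e
    ... | false with x ≟ v | y ≟ v
    ...   | yes x≡v | _ = inj₁ (refl , inj₁ (x≡v , sym (just-injective e)))
    ...   | no _ | yes y≡v = inj₁ (refl , inj₂ (y≡v , sym (just-injective e)))
    ...   | no _ | no _ = inj₂ e

  pathPartner-∈ : ∀ xs {v u} → pathPartner xs v ≡ just u → v ∈ xs × u ∈ xs
  pathPartner-∈ [] ()
  pathPartner-∈ (_ ∷ []) ()
  pathPartner-∈ (x ∷ y ∷ rest) {v} {u} e =
    [ on-first-edge , Product.map there there ∘ pathPartner-∈ (y ∷ rest) ]′ (pathPartner-cases {x} {y} {rest} e)
    where
      on-first-edge : MHedge x y ≡ false × (x ≡ v × u ≡ y ⊎ y ≡ v × u ≡ x)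
                    → v ∈ x ∷ y ∷ rest × u ∈ x ∷ y ∷ rest
      on-first-edge (_ , inj₁ (refl , refl)) = here refl , there (here refl)
      on-first-edge (_ , inj₂ (refl , refl)) = there (here refl) , here refl

  pathPartner-∉ : ∀ {xs v} → v ∉ xs → pathPartner xs v ≡ nothing
  pathPartner-∉ {xs} {v} v∉ with pathPartner xs v in e
  ... | nothing = refl
  ... | just u = contradiction (proj₁ (pathPartner-∈ xs e)) v∉

  AltStep : Bool → Fin N → Fin N → Set
  AltStep t x y = MHedge x y ≡ t × T (adj x y)

  open Trails AltStep public using ()
    renaming (Trail to AltTrail; head∈ to altTrail-head∈; last∈ to altTrail-last∈;
              closed-trail-trivial to closed-altTrail-trivial)

  pathPartner-adj : ∀ {t x xs w te v u} → AltTrail t x xs w te → pathPartner xs v ≡ just u → T (adj v u)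
  pathPartner-adj {xs = x ∷ y ∷ rest} ((_ , xy) ▸ p) e with pathPartner-cases {x} {y} {rest} e
  ... | inj₁ (_ , inj₁ (refl , refl)) = xy
  ... | inj₁ (_ , inj₂ (refl , refl)) = subst T (adj-sym x y) xy
  ... | inj₂ e′ = pathPartner-adj p e′

  pathPartner-at-MH-head : ∀ {x xs w te} → AltTrail true x xs w te → Unique xs → pathPartner xs x ≡ nothing
  pathPartner-at-MH-head nil _ = refl
  pathPartner-at-MH-head {x} {x ∷ y ∷ rest} ((mh , _) ▸ _) uniq =
    trans (pathPartner-skip {x} {y} {rest} mh) (pathPartner-∉ (unique-head∉ uniq))

  pathPartner-at-MH-last : ∀ {t x xs w} → AltTrail t x xs w false → Unique xs → pathPartner xs w ≡ nothing
  pathPartner-at-MH-last nil _ = refl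
  pathPartner-at-MH-last {true} {x} {x ∷ y ∷ rest} ((mh , _) ▸ p) uniq =
    trans (pathPartner-skip {x} {y} {rest} mh) (pathPartner-at-MH-last p (unique-tail uniq))
  pathPartner-at-MH-last {false} {x} {x ∷ y ∷ rest} {w} ((mh , _) ▸ p) uniq with toSum (y ≟ w)
  ... | inj₁ refl = contradiction (closed-altTrail-trivial p (unique-tail uniq)) λ ()
  ... | inj₂ y≢w = trans (pathPartner-other {x} {y} {rest} x≢w y≢w) (pathPartner-at-MH-last p (unique-tail uniq))
    where
      x≢w : x ≢ w
      x≢w refl = unique-head∉ uniq (altTrail-last∈ p)

  pathPartner-symmetric : ∀ {t x xs w te v u} → AltTrail t x xs w te → Unique xs
                        → pathPartner xs v ≡ just u → pathPartner xs u ≡ just v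
  pathPartner-symmetric {true} {x} {x ∷ y ∷ rest} ((mh , _) ▸ p) uniq e =
    trans (pathPartner-skip {x} {y} {rest} mh)
      (pathPartner-symmetric p (unique-tail uniq) (trans (sym (pathPartner-skip {x} {y} {rest} mh)) e))
  pathPartner-symmetric {false} {x} {x ∷ y ∷ rest} {v = v} {u} ((mh , _) ▸ p) uniq e
    with pathPartner-cases {x} {y} {rest} e
  ... | inj₁ (_ , inj₁ (refl , refl)) =
    pathPartner-second {x} {y} {rest} mh λ { refl → unique-head∉ uniq (here refl) }
  ... | inj₁ (_ , inj₂ (refl , refl)) = pathPartner-first {x} {y} {rest} mh
  ... | inj₂ e′ = trans (pathPartner-other {x} {y} {rest} x≢u y≢u) back
    where
      back : pathPartner (y ∷ rest) u ≡ just v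
      back = pathPartner-symmetric p (unique-tail uniq) e′
      x≢u : x ≢ u
      x≢u refl = unique-head∉ uniq (proj₁ (pathPartner-∈ (y ∷ rest) back))
      y≢u : y ≢ u
      y≢u refl = contradiction (trans (sym (pathPartner-at-MH-head p (unique-tail uniq))) back) λ ()

  pathPartner-undefined : ∀ {t x xs w te v} → AltTrail t x xs w te → Unique xs → v ∈ xs
                        → pathPartner xs v ≡ nothing → v ≡ x × t ≡ true ⊎ v ≡ w × te ≡ false
  pathPartner-undefined {true} nil _ (here refl) _ = inj₁ (refl , refl)
  pathPartner-undefined {false} nil _ (here refl) _ = inj₂ (refl , refl)
  pathPartner-undefined {true} (_ ▸ _) _ (here refl) _ = inj₁ (refl , refl)
  pathPartner-undefined {true} {x} {x ∷ y ∷ rest} ((mh , _) ▸ p) uniq (there v∈) e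
    with pathPartner-undefined p (unique-tail uniq) v∈ (trans (sym (pathPartner-skip {x} {y} {rest} mh)) e)
  ... | inj₂ at-last = inj₂ at-last
  pathPartner-undefined {false} {x} {x ∷ y ∷ rest} ((mh , _) ▸ p) _ (here refl) e =
    contradiction (trans (sym e) (pathPartner-first {x} {y} {rest} mh)) λ ()
  pathPartner-undefined {false} {x} {x ∷ y ∷ rest} {w} {te} {v} ((mh , _) ▸ p) uniq (there v∈) e =
    beyond-head (toSum (y ≟ v))
    where
      x≢v : x ≢ v
      x≢v refl = unique-head∉ uniq v∈
      beyond-head : y ≡ v ⊎ y ≢ v → v ≡ x × false ≡ true ⊎ v ≡ w × te ≡ false
      beyond-head (inj₁ refl) = contradiction (trans (sym e) (pathPartner-second {x} {y} {rest} mh x≢v)) λ ()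
      beyond-head (inj₂ y≢v)
        with pathPartner-undefined p (unique-tail uniq) v∈ (trans (sym (pathPartner-other {x} {y} {rest} x≢v y≢v)) e)
      ... | inj₁ (v≡y , _) = contradiction (sym v≡y) y≢v
      ... | inj₂ at-last = inj₂ at-last

  MH-at-head : ∀ {x y rest w te} → AltTrail true x (x ∷ y ∷ rest) w te → h x ≡ just y
  MH-at-head ((mh , _) ▸ _) = MHedge⇒h mh

  MH-at-last : ∀ {t x y rest w} → AltTrail t x (x ∷ y ∷ rest) w false → ∃ λ z → h w ≡ just z
  MH-at-last {true} {x} ((mh , _) ▸ nil) = x , MH.involutive (MHedge⇒h mh)
  MH-at-last (_ ▸ p@(_ ▸ _)) = MH-at-last p

  MH-at-open-head : ∀ {x xs w te} → AltTrail true x xs w te → x ≢ w → ∃ λ y → h x ≡ just y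
  MH-at-open-head nil x≢w = contradiction refl x≢w
  MH-at-open-head p@(_ ▸ _) _ = _ , MH-at-head p

  MH-at-open-last : ∀ {t x xs w} → AltTrail t x xs w false → x ≢ w → ∃ λ y → h w ≡ just y
  MH-at-open-last nil x≢w = contradiction refl x≢w
  MH-at-open-last p@(_ ▸ _) _ = MH-at-last p

  -- The side conditions admit an endpoint only if its edge on the path is in M_H.
  MH-partner∈ : ∀ {t x xs w te u y} → AltTrail t x xs w te → u ∈ xs
              → (u ≡ x → t ≡ true) → (u ≡ w → te ≡ false) → h u ≡ just y → y ∈ xs
  MH-partner∈ nil (here refl) head last _ = contradiction (trans (sym (head refl)) (last refl)) λ ()
  MH-partner∈ ((mh , _) ▸ p) (here refl) head _ e rewrite head refl =
    there (here (just-injective (trans (sym e) (MHedge⇒h mh))))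
  MH-partner∈ {t} {x} {x ∷ y ∷ rest} {u = u} ((mh , _) ▸ p) (there u∈) _ last e with toSum (y ≟ u) | t
  ... | inj₁ refl | true = here (just-injective (trans (sym e) (MH.involutive (MHedge⇒h mh))))
  ... | inj₁ refl | false = there (MH-partner∈ p u∈ (λ _ → refl) last e)
  ... | inj₂ y≢u | _ = there (MH-partner∈ p u∈ (λ u≡y → contradiction (sym u≡y) y≢u) last e)

  elem⁻ : ∀ {x xs} → T (elem G a inK MH x xs) → x ∈ xs
  elem⁻ {xs = y ∷ ys} e with T-∨⁻ e
  ... | inj₁ x≡y = here (==⇒≡ x≡y)
  ... | inj₂ x∈ys = there (elem⁻ x∈ys)

  elem⁺ : ∀ {x xs} → x ∈ xs → T (elem G a inK MH x xs)
  elem⁺ {x} (here refl) = T-∨⁺ˡ (==-refl x)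
  elem⁺ (there x∈) = T-∨⁺ʳ (elem⁺ x∈)

  distinctL⁻ : ∀ {xs} → T (distinctL G a inK MH xs) → Unique xs
  distinctL⁻ {[]} _ = []
  distinctL⁻ {x ∷ xs} d = unique-cons (T-not⁻ (proj₁ (T-∧⁻ d)) ∘ elem⁺) (distinctL⁻ (proj₂ (T-∧⁻ d)))

  distinctL⁺ : ∀ {xs} → Unique xs → T (distinctL G a inK MH xs)
  distinctL⁺ [] = _
  distinctL⁺ u@(_ ∷ _) = T-∧⁺ (T-not⁺ (unique-head∉ u ∘ elem⁻)) (distinctL⁺ (unique-tail u))

  disjointL⁻ : ∀ {xs ys} → T (disjointL G a inK MH xs ys) → Disjoint xs ys
  disjointL⁻ {x ∷ xs} d (here refl , x∈ys) = T-not⁻ (proj₁ (T-∧⁻ d)) (elem⁺ x∈ys)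
  disjointL⁻ {x ∷ xs} d (there v∈xs , v∈ys) = disjointL⁻ (proj₂ (T-∧⁻ d)) (v∈xs , v∈ys)

  disjointL⁺ : ∀ {xs ys} → Disjoint xs ys → T (disjointL G a inK MH xs ys)
  disjointL⁺ {[]} _ = _
  disjointL⁺ {x ∷ xs} d =
    T-∧⁺ (T-not⁺ λ x∈ys → d (here refl , elem⁻ x∈ys)) (disjointL⁺ λ (v∈xs , v∈ys) → d (there v∈xs , v∈ys))

  containsEdge⁻ : ∀ {u v x y rest} → T (containsEdge G a inK MH u v (x ∷ y ∷ rest))
                → x ≡ u × y ≡ v ⊎ x ≡ v × y ≡ u ⊎ T (containsEdge G a inK MH u v (y ∷ rest))
  containsEdge⁻ c with T-∨⁻ c
  ... | inj₁ uv = inj₁ (Product.map ==⇒≡ ==⇒≡ (T-∧⁻ uv))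
  ... | inj₂ c′ with T-∨⁻ c′
  ...   | inj₁ vu = inj₂ (inj₁ (Product.map ==⇒≡ ==⇒≡ (T-∧⁻ vu)))
  ...   | inj₂ later = inj₂ (inj₂ later)

  containsEdge-∈ : ∀ {u v} xs → T (containsEdge G a inK MH u v xs) → u ∈ xs
  containsEdge-∈ [] ()
  containsEdge-∈ (_ ∷ []) ()
  containsEdge-∈ {u} {v} (x ∷ y ∷ rest) c =
    first-or-later (containsEdge⁻ {u} {v} {x} {y} {rest} c) (containsEdge-∈ (y ∷ rest))
    where
      first-or-later : x ≡ u × y ≡ v ⊎ x ≡ v × y ≡ u ⊎ T (containsEdge G a inK MH u v (y ∷ rest))
                     → (T (containsEdge G a inK MH u v (y ∷ rest)) → u ∈ y ∷ rest) → u ∈ x ∷ y ∷ rest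
      first-or-later (inj₁ (refl , _)) _ = here refl
      first-or-later (inj₂ (inj₁ (_ , refl))) _ = there (here refl)
      first-or-later (inj₂ (inj₂ later)) ih = there (ih later)

  containsEdge-at-head : ∀ {t x y rest w te} → AltTrail t x (x ∷ y ∷ rest) w te
                       → T (containsEdge G a inK MH x y (x ∷ y ∷ rest))
  containsEdge-at-head {x = x} {y} _ = T-∨⁺ˡ (T-∧⁺ (==-refl x) (==-refl y))

  containsEdge-at-head⇒MH : ∀ {t x xs w te y} → AltTrail t x xs w te → Unique xs → h x ≡ just y
                          → T (containsEdge G a inK MH x y xs) → t ≡ true
  containsEdge-at-head⇒MH {x = x} {x ∷ y ∷ rest} {y = z} ((mh , _) ▸ _) uniq hx c
    with containsEdge⁻ {x} {z} {x} {y} {rest} c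
  ... | inj₁ (_ , refl) = trans (sym mh) (h⇒MHedge hx)
  ... | inj₂ (inj₁ (_ , refl)) = contradiction (here refl) (unique-head∉ uniq)
  ... | inj₂ (inj₂ later) = contradiction (containsEdge-∈ (y ∷ rest) later) (unique-head∉ uniq)

  containsEdge-at-last⇒MH : ∀ {t x xs w te y} → AltTrail t x xs w te → Unique xs → h w ≡ just y
                          → T (containsEdge G a inK MH w y xs) → te ≡ false
  containsEdge-at-last⇒MH {t} {x} {x ∷ y ∷ rest} {w} {y = z} ((mh , _) ▸ p) uniq hw c
    with containsEdge⁻ {w} {z} {x} {y} {rest} c
  ... | inj₁ (refl , _) = contradiction (altTrail-last∈ p) (unique-head∉ uniq)
  ... | inj₂ (inj₁ (refl , refl)) rewrite closed-altTrail-trivial p (unique-tail uniq) =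
    cong not (trans (sym mh) (h⇒MHedge (MH.involutive hw)))
  ... | inj₂ (inj₂ later) = containsEdge-at-last⇒MH p (unique-tail uniq) hw later

  containsEdge-at-MH-last : ∀ {t x y rest w z} → AltTrail t x (x ∷ y ∷ rest) w false → h w ≡ just z
                          → T (containsEdge G a inK MH w z (x ∷ y ∷ rest))
  containsEdge-at-MH-last {true} {x} {y} ((mh , _) ▸ nil) hw
    rewrite just-injective (trans (sym hw) (MH.involutive (MHedge⇒h mh))) =
      T-∨⁺ʳ {(x == y) ∧ (y == x)} (T-∨⁺ˡ (T-∧⁺ (==-refl x) (==-refl y)))
  containsEdge-at-MH-last {x = x} {y} {w = w} {z} (_ ▸ p@(_ ▸ _)) hw =
    T-∨⁺ʳ {(x == w) ∧ (y == z)} (T-∨⁺ʳ {(x == z) ∧ (y == w)} (containsEdge-at-MH-last p hw))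

  endCond⁻ : ∀ {x xs} → T (endCond G a inK MH x xs) → T (inAH a inK x)
           → ∃ λ y → h x ≡ just y × T (containsEdge G a inK MH x y xs)
  endCond⁻ {x} ok ah with h x
  ... | just y = y , refl , [ (λ ¬ah → contradiction ah (T-not⁻ ¬ah)) , (λ c → c) ]′ (T-∨⁻ ok)
  ... | nothing = contradiction ah (T-not⁻ ok)

  endCond⁺ : ∀ {x xs} → (T (inAH a inK x) → ∃ λ y → h x ≡ just y × T (containsEdge G a inK MH x y xs))
           → T (endCond G a inK MH x xs)
  endCond⁺ {x} {xs} edge with h x
  ... | nothing = T-not⁺ λ ah → case edge ah of λ where (_ , () , _)
  ... | just y with inAH a inK x
  ...   | false = _
  ...   | true with edge _
  ...     | _ , refl , c = T-∨⁺ʳ {false} c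

  -- isAltPath as a proposition; its end conditions become conditions on the colours of the end edges.
  record AltPath (x z : Fin N) (xs : List (Fin N)) : Set where
    field
      {colour endColour} : Bool
      trail : AltTrail colour x xs z endColour
      unique : Unique xs
      starts-in-MH : T (inAH a inK x) → colour ≡ true
      ends-in-MH : T (inAH a inK z) → endColour ≡ false

  private
    xor⇒flipped : ∀ b c → T (b xor c) → c ≡ not b
    xor⇒flipped false true _ = refl
    xor⇒flipped true false _ = refl

    xor-flipped : ∀ b → T (b xor not b)
    xor-flipped false = _
    xor-flipped true = _

  altTrail⁺ : ∀ x y rest z
            → T (consecAdj G a inK MH (x ∷ y ∷ rest)) → T (alternates G a inK MH (x ∷ y ∷ rest))
            → T (endsAt G a inK MH z (x ∷ y ∷ rest)) → ∃ λ te → AltTrail (MHedge x y) x (x ∷ y ∷ rest) z te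
  altTrail⁺ x y [] z adjs _ ends rewrite ==⇒≡ ends = _ , (refl , proj₁ (T-∧⁻ adjs)) ▸ nil
  altTrail⁺ x y (w ∷ rest) z adjs alts ends
    with T-∧⁻ {adj x y} adjs | T-∧⁻ {MHedge x y xor MHedge y w} alts
  ... | xy , adjs′ | flips , alts′ with altTrail⁺ y w rest z adjs′ alts′ ends
  ...   | te , p rewrite xor⇒flipped (MHedge x y) (MHedge y w) flips = te , (refl , xy) ▸ p

  altTrail-consecAdj : ∀ {t x xs w te} → AltTrail t x xs w te → T (consecAdj G a inK MH xs)
  altTrail-consecAdj nil = _
  altTrail-consecAdj ((_ , xy) ▸ p) = T-∧⁺ xy (altTrail-consecAdj p)

  altTrail-alternates : ∀ {t x xs w te} → AltTrail t x xs w te → T (alternates G a inK MH xs)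
  altTrail-alternates nil = _
  altTrail-alternates (_ ▸ nil) = _
  altTrail-alternates {t} ((mh , _) ▸ p@((mh′ , _) ▸ _)) =
    T-∧⁺ (subst₂ (λ b c → T (b xor c)) (sym mh) (sym mh′) (xor-flipped t)) (altTrail-alternates p)

  altTrail-endsAt : ∀ {t x xs w te} → AltTrail t x xs w te → T (endsAt G a inK MH w xs)
  altTrail-endsAt {x = x} nil = ==-refl x
  altTrail-endsAt (_ ▸ p) = altTrail-endsAt p

  altTrail-endsAt⁻ : ∀ {t x xs w te z} → AltTrail t x xs w te → T (endsAt G a inK MH z xs) → z ≡ w
  altTrail-endsAt⁻ nil ends = ==⇒≡ ends
  altTrail-endsAt⁻ (_ ▸ p) ends = altTrail-endsAt⁻ p ends

  module _ {x z : Fin N} {xs : List (Fin N)} where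

    isAltPath-parts : T (isAltPath G a inK MH x z xs)
      → T (startsAt G a inK MH x xs) × T (endsAt G a inK MH z xs) × Unique xs
      × T (consecAdj G a inK MH xs) × T (alternates G a inK MH xs)
      × T (endCond G a inK MH x xs) × T (endCond G a inK MH z xs)
    isAltPath-parts ok with T-∧⁻ {startsAt G a inK MH x xs} ok
    ... | starts , ok₁ with T-∧⁻ {endsAt G a inK MH z xs} ok₁
    ... | ends , ok₂ with T-∧⁻ {distinctL G a inK MH xs} ok₂
    ... | distinct , ok₃ with T-∧⁻ {consecAdj G a inK MH xs} ok₃
    ... | adjs , ok₄ with T-∧⁻ {alternates G a inK MH xs} ok₄
    ... | alts , ok₅ with T-∧⁻ {endCond G a inK MH x xs} ok₅
    ... | start-ok , end-ok = starts , ends , distinctL⁻ distinct , adjs , alts , start-ok , end-ok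

  list⇒altTrail : ∀ {x z} xs → T (startsAt G a inK MH x xs) → T (endsAt G a inK MH z xs)
                → T (consecAdj G a inK MH xs) → T (alternates G a inK MH xs)
                → ∃ λ t → ∃ λ te → AltTrail t x xs z te
  list⇒altTrail (y ∷ []) starts ends _ _ with ==⇒≡ starts | ==⇒≡ ends
  ... | refl | refl = true , true , nil
  list⇒altTrail {z = z} (y ∷ w ∷ rest) starts ends adjs alts with ==⇒≡ starts
  ... | refl = _ , altTrail⁺ y w rest z adjs alts ends

  isAltPath⁻ : ∀ {x z xs} → T (isAltPath G a inK MH x z xs) → AltPath x z xs
  isAltPath⁻ ok with isAltPath-parts ok
  ... | starts , ends , uniq , adjs , alts , start-ok , end-ok with list⇒altTrail _ starts ends adjs alts
  ...   | _ , _ , p = record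
    { trail = p ; unique = uniq
    ; starts-in-MH = λ ah → case endCond⁻ start-ok ah of λ where
        (_ , hx , c) → containsEdge-at-head⇒MH p uniq hx c
    ; ends-in-MH = λ ah → case endCond⁻ end-ok ah of λ where
        (_ , hz , c) → containsEdge-at-last⇒MH p uniq hz c }

  altTrail-startsAt : ∀ {t x xs w te} → AltTrail t x xs w te → T (startsAt G a inK MH x xs)
  altTrail-startsAt {x = x} nil = ==-refl x
  altTrail-startsAt {x = x} (_ ▸ _) = ==-refl x

  isAltPath⁺ : ∀ {x z xs} → AltPath x z xs → T (isAltPath G a inK MH x z xs)
  isAltPath⁺ {x} {z} {xs} P =
    T-∧⁺ (altTrail-startsAt trail) (T-∧⁺ (altTrail-endsAt trail) (T-∧⁺ (distinctL⁺ unique)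
      (T-∧⁺ (altTrail-consecAdj trail) (T-∧⁺ (altTrail-alternates trail)
        (T-∧⁺ (endCond⁺ (start-edge trail)) (endCond⁺ (end-edge trail)))))))
    where
      open AltPath P
      start-edge : AltTrail colour x xs z endColour → T (inAH a inK x)
                 → ∃ λ y → h x ≡ just y × T (containsEdge G a inK MH x y xs)
      start-edge nil ah = contradiction (trans (sym (starts-in-MH ah)) (ends-in-MH ah)) λ ()
      start-edge p@(_ ▸ _) ah =
        _ , MH-at-head (subst (λ c → AltTrail c _ _ _ _) (starts-in-MH ah) p) , containsEdge-at-head p
      end-edge : AltTrail colour x xs z endColour → T (inAH a inK z)
               → ∃ λ y → h z ≡ just y × T (containsEdge G a inK MH z y xs)
      end-edge nil ah = contradiction (trans (sym (starts-in-MH ah)) (ends-in-MH ah)) λ ()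
      end-edge p@(_ ▸ _) ah with subst (AltTrail _ _ _ _) (ends-in-MH ah) p
      ... | p′ with MH-at-last p′
      ...   | y , hz = y , hz , containsEdge-at-MH-last p′ hz

  isEmpty⇔ : ∀ {xs} → T (isEmpty G a inK MH xs) ⇔ xs ≡ []
  isEmpty⇔ {[]} = mk⇔ (λ _ → refl) (λ _ → _)
  isEmpty⇔ {_ ∷ _} = mk⇔ (λ ()) (λ ())

  Entry : Fin n → List (Fin N) → Set
  Entry i xs = xs ≡ [] ⊎ ∃ λ j → T (i <F j) × AltPath (a i) (a j) xs

  module _ (ν : Vec (List (Fin N)) n) where

    entryOK⁻ : ∀ {i} → T (entryOK G a inK MH ν i) → Entry i (lookup ν i)
    entryOK⁻ {i} ok with T-∨⁻ ok
    ... | inj₁ empty = inj₁ (Equivalence.to isEmpty⇔ empty)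
    ... | inj₂ some with anyF⁻ some
    ...   | j , q = inj₂ (j , proj₁ (T-∧⁻ {i <F j} q) , isAltPath⁻ (proj₂ (T-∧⁻ {i <F j} q)))

    entryOK⁺ : ∀ {i} → Entry i (lookup ν i) → T (entryOK G a inK MH ν i)
    entryOK⁺ (inj₁ empty) = T-∨⁺ˡ (Equivalence.from isEmpty⇔ empty)
    entryOK⁺ {i} (inj₂ (j , i<j , path)) =
      T-∨⁺ʳ {isEmpty G a inK MH (lookup ν i)} (anyF⁺ j (T-∧⁺ i<j (isAltPath⁺ path)))

    endpointOf⁻ : ∀ {k i} → T (endpointOf G a inK MH ν k i)
                → lookup ν i ≢ [] × (i ≡ k ⊎ T (endsAt G a inK MH (a k) (lookup ν i)))
    endpointOf⁻ e with T-∧⁻ e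
    ... | nonempty , which =
      T-not⁻ nonempty ∘ Equivalence.from isEmpty⇔ , Sum.map₁ ==⇒≡ (T-∨⁻ which)

    endpointOf⁺ : ∀ {k i} → lookup ν i ≢ [] → i ≡ k ⊎ T (endsAt G a inK MH (a k) (lookup ν i))
                → T (endpointOf G a inK MH ν k i)
    endpointOf⁺ {k} {i} nonempty which =
      T-∧⁺ (T-not⁺ (nonempty ∘ Equivalence.to isEmpty⇔))
           ([ (λ { refl → T-∨⁺ˡ (==-refl i) }) , T-∨⁺ʳ {i == k} ]′ which)

    nonIntersecting⁻ : T (nonIntersecting G a inK MH ν)
                     → ∀ {i j x} → x ∈ lookup ν i → x ∈ lookup ν j → i ≡ j
    nonIntersecting⁻ ok {i} {j} x∈i x∈j with T-∨⁻ (allF⁻ (allF⁻ ok i) j)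
    ... | inj₁ i≡j = ==⇒≡ i≡j
    ... | inj₂ disjoint = contradiction (x∈i , x∈j) (disjointL⁻ disjoint)

    nonIntersecting⁺ : (∀ {i j x} → x ∈ lookup ν i → x ∈ lookup ν j → i ≡ j)
                     → T (nonIntersecting G a inK MH ν)
    nonIntersecting⁺ meet = allF⁺ λ i → allF⁺ λ j → case toSum (i ≟ j) of λ where
      (inj₁ i≡j) → T-∨⁺ˡ (≡⇒== i≡j)
      (inj₂ i≢j) → T-∨⁺ʳ {i == j} (disjointL⁺ λ (x∈i , x∈j) → i≢j (meet x∈i x∈j))

  Coloured : (Fin N → Maybe (Fin N)) → Bool → Fin N → Maybe (Fin N)
  Coloured μ true = h
  Coloured μ false = μ

  ColouredStep : (Fin N → Maybe (Fin N)) → Bool → Fin N → Fin N → Set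
  ColouredStep μ t x y = Coloured μ t x ≡ just y

  altTrail⇒colouredTrail : ∀ {μ t x xs w te} → AltTrail t x xs w te → Unique xs
    → (∀ {v} → v ∈ xs → (v ≡ x → t ≡ false) → μ v ≡ pathPartner xs v)
    → Trails.Trail (ColouredStep μ) t x xs w te
  altTrail⇒colouredTrail nil _ _ = nil
  altTrail⇒colouredTrail {t = true} {x} {x ∷ y ∷ rest} ((mh , _) ▸ p) uniq agrees =
    MHedge⇒h mh ▸ altTrail⇒colouredTrail p (unique-tail uniq) λ v∈ _ →
      trans (agrees (there v∈) λ { refl → contradiction v∈ (unique-head∉ uniq) })
            (pathPartner-skip {x} {y} {rest} mh)
  altTrail⇒colouredTrail {t = false} {x} {x ∷ y ∷ rest} ((mh , _) ▸ p) uniq agrees =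
    trans (agrees (here refl) (λ _ → refl)) (pathPartner-first {x} {y} {rest} mh) ▸
    altTrail⇒colouredTrail p (unique-tail uniq) λ {v} v∈ v≢y →
      trans (agrees (there v∈) λ { refl → contradiction v∈ (unique-head∉ uniq) })
            (pathPartner-other {x} {y} {rest} (λ { refl → unique-head∉ uniq v∈ })
                                              (λ { refl → contradiction (v≢y refl) λ () }))

  -- From a perfect matching of K to a nest

  module FromMatching (MK : PerfectMatching G (vertsK a inK)) where

    m : Fin N → Maybe (Fin N)
    m = lookup (proj₁ MK)

    m-matching : IsPerfectMatchingOf G (vertsK a inK) m
    m-matching = isPerfectMatching⁻ G {p = proj₁ MK} (proj₂ MK)

    module MK = IsPerfectMatchingOf m-matching

    open Unmatched {not ∘ inK} m-matching
      renaming (unmatched⇒a to m-unmatched⇒AH; unmatched-at-a to m-unmatched-at-AH)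

    P : Bool → Fin N → Maybe (Fin N)
    P = Coloured m

    P-involutive : ∀ {t x y} → P t x ≡ just y → P t y ≡ just x
    P-involutive {true} = MH.involutive
    P-involutive {false} = MK.involutive

    P-irreflexive : ∀ {t x} → P t x ≢ just x
    P-irreflexive {true} = MH.irreflexive
    P-irreflexive {false} = MK.irreflexive

    open AlternatingWalks P (λ {t} → P-involutive {t}) (λ {t} → P-irreflexive {t}) public

    a-unmatched : ∀ k → P (inK k) (a k) ≡ nothing
    a-unmatched k with inK k in K
    ... | true = h-unmatched-at-AK (subst T (sym K) _)
    ... | false = m-unmatched-at-AH (subst (T ∘ not) (sym K) _)

    stop⇒a : ∀ {te w} → P te w ≡ nothing → ∃ λ j → a j ≡ w × te ≡ inK j
    stop⇒a {true} e with h-unmatched⇒AK e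
    ... | j , aj≡w , K = j , aj≡w , sym (Equivalence.to T-≡ K)
    stop⇒a {false} e with m-unmatched⇒AH e
    ... | j , aj≡w , ¬K = j , aj≡w , sym (Equivalence.to T-not-≡ ¬K)

    start-unmatched : ∀ k → P (not (not (inK k))) (a k) ≡ nothing
    start-unmatched k = subst (λ c → P c (a k) ≡ nothing) (sym (not-involutive (inK k))) (a-unmatched k)

    -- The walk from a_k starts along M_H if a_k ∈ A_H and along M_K if a_k ∈ A_K.
    record WalkFrom (k : Fin n) (xs : List (Fin N)) : Set where
      field
        far : Fin n
        trail : Trail (not (inK k)) (a k) xs (a far) (inK far)

      maximal-walk : MaximalWalk (not (inK k)) (a k) xs
      maximal-walk = maximal trail (a-unmatched far)

    -- Opaque so that the type checker never unfolds the fuel-driven search.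
    opaque
      walkFrom : ∀ k → ∃ λ xs → WalkFrom k xs × Unique xs
      walkFrom k with maximal-walk-exists (start-unmatched k)
      ... | xs , maximal {w} {te} p stop , uniq with stop⇒a {te} {w} stop
      ...   | j , refl , refl = xs , record { far = j ; trail = p } , uniq

    walkFrom-deterministic : ∀ {k xs ys} → WalkFrom k xs → WalkFrom k ys → xs ≡ ys
    walkFrom-deterministic W W′ = maximal-walk-deterministic (WalkFrom.maximal-walk W) (WalkFrom.maximal-walk W′)

    walkFrom-far : ∀ {k k′ xs ys} (W : WalkFrom k xs) (W′ : WalkFrom k′ ys) → xs ≡ ys
                 → WalkFrom.far W ≡ WalkFrom.far W′
    walkFrom-far W W′ refl = a-injective _ _ (last-unique (WalkFrom.trail W) (WalkFrom.trail W′))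

    walk : Fin n → List (Fin N)
    walk k = proj₁ (walkFrom k)

    walk-walkFrom : ∀ k → WalkFrom k (walk k)
    walk-walkFrom k = proj₁ (proj₂ (walkFrom k))

    opposite : Fin n → Fin n
    opposite k = WalkFrom.far (walk-walkFrom k)

    walk-trail : ∀ k → Trail (not (inK k)) (a k) (walk k) (a (opposite k)) (inK (opposite k))
    walk-trail k = WalkFrom.trail (walk-walkFrom k)

    walk-unique : ∀ k → Unique (walk k)
    walk-unique k = proj₂ (proj₂ (walkFrom k))

    reverse-walkFrom : ∀ {k xs} (W : WalkFrom k xs) → WalkFrom (WalkFrom.far W) (reverse xs)
    reverse-walkFrom {k} W = record
      { far = k
      ; trail = subst (Trail _ _ _ (a k)) (not-involutive (inK k))
                      (reverse-trail (λ {t} → P-involutive {t}) (WalkFrom.trail W)) }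

    walk-opposite : ∀ k → walk (opposite k) ≡ reverse (walk k)
    walk-opposite k = walkFrom-deterministic (walk-walkFrom (opposite k)) (reverse-walkFrom (walk-walkFrom k))

    opposite-involutive : ∀ k → opposite (opposite k) ≡ k
    opposite-involutive k =
      walkFrom-far (walk-walkFrom (opposite k)) (reverse-walkFrom (walk-walkFrom k)) (walk-opposite k)

    opposite≢ : ∀ k → opposite k ≢ k
    opposite≢ k k′≡k = not-¬ refl (closed-trail-trivial closed (walk-unique k))
      where
        closed : Trail (not (inK k)) (a k) (walk k) (a k) (inK k)
        closed = subst (λ j → Trail (not (inK k)) (a k) (walk k) (a j) (inK j)) k′≡k (walk-trail k)

    walks-meet : ∀ {i j x} → x ∈ walk i → x ∈ walk j → j ≡ i ⊎ j ≡ opposite i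
    walks-meet {i} {j} x∈i x∈j
      with maximal-walks-meet (start-unmatched i) (WalkFrom.maximal-walk (walk-walkFrom i))
                              (start-unmatched j) (WalkFrom.maximal-walk (walk-walkFrom j)) x∈i x∈j
    ... | inj₁ aj≡ai = inj₁ (a-injective j i aj≡ai)
    ... | inj₂ aj≡end = inj₂ (a-injective j (opposite i) aj≡end)

    -- A step along M_K is not in M_H: otherwise the walk would turn straight back.
    MK-step-not-MH : ∀ {v y ys w te} → Unique (v ∷ y ∷ ys) → Trail true y (y ∷ ys) w te → P te w ≡ nothing
                   → h v ≢ just y
    MK-step-not-MH _ nil stop hv = contradiction (trans (sym stop) (MH.involutive hv)) λ ()
    MK-step-not-MH uniq (e ▸ p) _ hv with just-injective (trans (sym e) (MH.involutive hv))
    ... | refl = unique-head∉ uniq (there (head∈ p))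

    walk⇒altTrail : ∀ {t v xs w te} → Trail t v xs w te → Unique xs → P te w ≡ nothing → AltTrail t v xs w te
    walk⇒altTrail nil _ _ = nil
    walk⇒altTrail {true} (e ▸ p) uniq stop = (h⇒MHedge e , MH.edge e) ▸ walk⇒altTrail p (unique-tail uniq) stop
    walk⇒altTrail {false} (e ▸ p) uniq stop =
      (¬h⇒¬MHedge (MK-step-not-MH uniq p stop) , MK.edge e) ▸ walk⇒altTrail p (unique-tail uniq) stop

    walk-altPath : ∀ k → AltPath (a k) (a (opposite k)) (walk k)
    walk-altPath k = record
      { trail = walk⇒altTrail (walk-trail k) (walk-unique k) (a-unmatched (opposite k))
      ; unique = walk-unique k
      ; starts-in-MH = λ ah → Equivalence.to T-≡ (a∈A⁻ ah)
      ; ends-in-MH = λ ah → Equivalence.to T-not-≡ (a∈A⁻ ah) }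

    walk-pathPartner⇒m : ∀ {t v xs w te x u} → Trail t v xs w te → pathPartner xs x ≡ just u → m x ≡ just u
    walk-pathPartner⇒m {t} {v} {v ∷ y ∷ rest} (e ▸ p) pp with pathPartner-cases {v} {y} {rest} pp | t
    ... | inj₁ (mh , _) | true = contradiction (trans (sym (h⇒MHedge e)) mh) λ ()
    ... | inj₁ (_ , inj₁ (refl , refl)) | false = e
    ... | inj₁ (_ , inj₂ (refl , refl)) | false = MK.involutive e
    ... | inj₂ pp′ | _ = walk-pathPartner⇒m p pp′

    walk-pathPartner : ∀ {k x} → x ∈ walk k → pathPartner (walk k) x ≡ m x
    walk-pathPartner {k} {x} x∈ with pathPartner (walk k) x in pp
    ... | just u = sym (walk-pathPartner⇒m (walk-trail k) pp)
    ... | nothing with pathPartner-undefined (AltPath.trail (walk-altPath k)) (walk-unique k) x∈ pp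
    ...   | inj₁ (refl , starts-MH) =
      sym (subst (λ c → Coloured m (not c) (a k) ≡ nothing) starts-MH (start-unmatched k))
    ...   | inj₂ (refl , ends-MH) =
      sym (subst (λ c → Coloured m c (a (opposite k)) ≡ nothing) ends-MH (a-unmatched (opposite k)))

    nestPath : Fin n → List (Fin N)
    nestPath k = if k <F opposite k then walk k else []

    nestPath-cases : ∀ k → T (k <F opposite k) × nestPath k ≡ walk k ⊎ ¬ T (k <F opposite k) × nestPath k ≡ []
    nestPath-cases k with k <F opposite k
    ... | true = inj₁ (_ , refl)
    ... | false = inj₂ ((λ ()) , refl)

    nestPath-nonempty : ∀ {k} → nestPath k ≢ [] → T (k <F opposite k) × nestPath k ≡ walk k
    nestPath-nonempty {k} nonempty with nestPath-cases k
    ... | inj₁ stored = stored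
    ... | inj₂ (_ , empty) = contradiction empty nonempty

    walk-nonempty : ∀ k → walk k ≢ []
    walk-nonempty k empty = case subst (a k ∈_) empty (head∈ (walk-trail k)) of λ ()

    opposite-stored : ∀ {k} → ¬ T (k <F opposite k) → T (opposite k <F opposite (opposite k))
    opposite-stored {k} k≮k′ =
      subst (λ j → T (opposite k <F j)) (sym (opposite-involutive k)) (<F-connex (opposite≢ k ∘ sym) k≮k′)

    nestPath-opposite : ∀ {k} → ¬ T (k <F opposite k) → nestPath (opposite k) ≡ walk (opposite k)
    nestPath-opposite {k} k≮k′ with nestPath-cases (opposite k)
    ... | inj₁ (_ , stored) = stored
    ... | inj₂ (k′≮k , _) = contradiction (opposite-stored k≮k′) k′≮k

    EndsAt : Fin n → Fin n → Set
    EndsAt k i = nestPath i ≢ [] × (i ≡ k ⊎ T (endsAt G a inK MH (a k) (nestPath i)))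

    EndsAt⇒ : ∀ {k i} → EndsAt k i → T (i <F opposite i) × (i ≡ k ⊎ opposite i ≡ k)
    EndsAt⇒ {k} {i} (nonempty , which) with nestPath-nonempty nonempty
    ... | i<i′ , stored = i<i′ , Sum.map₂ ends⇒opposite which
      where
        ends⇒opposite : T (endsAt G a inK MH (a k) (nestPath i)) → opposite i ≡ k
        ends⇒opposite ends = a-injective _ _
          (sym (altTrail-endsAt⁻ (AltPath.trail (walk-altPath i)) (subst (T ∘ endsAt G a inK MH (a k)) stored ends)))

    endsAt-unique : ∀ k → ∃ λ i → EndsAt k i × (∀ j → EndsAt k j → j ≡ i)
    endsAt-unique k with nestPath-cases k
    ... | inj₁ (k<k′ , stored) = k , (subst (_≢ []) (sym stored) (walk-nonempty k) , inj₁ refl) , only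
      where
        only : ∀ j → EndsAt k j → j ≡ k
        only j ends with EndsAt⇒ ends
        ... | _ , inj₁ j≡k = j≡k
        ... | j<j′ , inj₂ refl =
          contradiction (subst (λ i → T (opposite j <F i)) (opposite-involutive j) k<k′) (<F-asym {i = j} j<j′)
    ... | inj₂ (k≮k′ , empty) =
      opposite k , (subst (_≢ []) (sym (nestPath-opposite k≮k′)) (walk-nonempty (opposite k)) , inj₂ ends) , only
      where
        ends : T (endsAt G a inK MH (a k) (nestPath (opposite k)))
        ends = subst (λ i → T (endsAt G a inK MH (a i) (nestPath (opposite k)))) (opposite-involutive k)
                 (subst (T ∘ endsAt G a inK MH _) (sym (nestPath-opposite k≮k′))
                        (altTrail-endsAt (AltPath.trail (walk-altPath (opposite k)))))
        only : ∀ j → EndsAt k j → j ≡ opposite k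
        only j ends with EndsAt⇒ ends
        ... | j<j′ , inj₁ refl = contradiction j<j′ k≮k′
        ... | _ , inj₂ refl = sym (opposite-involutive j)

    nest-meet : ∀ {i j x} → x ∈ nestPath i → x ∈ nestPath j → i ≡ j
    nest-meet {i} {j} x∈i x∈j with nestPath-nonempty (∈⇒nonempty x∈i) | nestPath-nonempty (∈⇒nonempty x∈j)
    ... | i<i′ , stored-i | j<j′ , stored-j
      with walks-meet (subst (_ ∈_) stored-i x∈i) (subst (_ ∈_) stored-j x∈j)
    ...   | inj₁ j≡i = sym j≡i
    ...   | inj₂ refl =
      contradiction (subst (λ k → T (opposite i <F k)) (opposite-involutive i) j<j′) (<F-asym {i = i} i<i′)

    nest-entry : ∀ i → Entry i (nestPath i)
    nest-entry i with nestPath-cases i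
    ... | inj₁ (i<i′ , stored) = inj₂ (opposite i , i<i′ , subst (AltPath _ _) (sym stored) (walk-altPath i))
    ... | inj₂ (_ , empty) = inj₁ empty

    nest : Vec (List (Fin N)) n
    nest = tabulate nestPath

    nest-valid : T (isNest G a inK MH nest ∧ nonIntersecting G a inK MH nest)
    nest-valid = T-∧⁺ (T-∧⁺ (allF⁺ entry) (allF⁺ endpoint-unique)) (nonIntersecting⁺ nest meet)
      where
        entry : ∀ i → T (entryOK G a inK MH nest i)
        entry i = entryOK⁺ nest (subst (Entry i) (sym (lookup∘tabulate nestPath i)) (nest-entry i))
        endpoint⁺ : ∀ {k i} → EndsAt k i → T (endpointOf G a inK MH nest k i)
        endpoint⁺ {k} {i} (nonempty , which) =
          endpointOf⁺ nest (subst (_≢ []) (sym stored) nonempty)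
                           (Sum.map₂ (subst (T ∘ endsAt G a inK MH (a k)) (sym stored)) which)
          where stored = lookup∘tabulate nestPath i
        endpoint⁻ : ∀ {k i} → T (endpointOf G a inK MH nest k i) → EndsAt k i
        endpoint⁻ {k} {i} e with endpointOf⁻ nest e
        ... | nonempty , which =
          subst (_≢ []) stored nonempty , Sum.map₂ (subst (T ∘ endsAt G a inK MH (a k)) stored) which
          where stored = lookup∘tabulate nestPath i
        endpoint-unique : ∀ k → T (countF (endpointOf G a inK MH nest k) ≡ᵇ 1)
        endpoint-unique k with endsAt-unique k
        ... | i , ends , only = countF-one i (endpoint⁺ ends) λ j e → only j (endpoint⁻ e)
        meet : ∀ {i j x} → x ∈ lookup nest i → x ∈ lookup nest j → i ≡ j
        meet {i} {j} rewrite lookup∘tabulate nestPath i | lookup∘tabulate nestPath j = nest-meet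

    walk-closed : ∀ {k v s u} → v ∈ walk k → P s v ≡ just u → u ∈ walk k
    walk-closed {k} {s = s} = maximal-walk-closed {s = s} (start-unmatched k) (WalkFrom.maximal-walk (walk-walkFrom k))

    OnWalk : Fin N → Set
    OnWalk v = ∃ λ k → v ∈ walk k

    onWalk? : ∀ v → Dec (OnWalk v)
    onWalk? v = any? (λ k → v ∈? walk k)
      where open import Data.List.Membership.DecPropositional (_≟_ {N}) using (_∈?_)

    -- M_H on the walks and M_K elsewhere: another perfect matching of H.
    spliced : Fin N → Maybe (Fin N)
    spliced v = if does (onWalk? v) then h v else m v

    spliced-on : ∀ {v} → OnWalk v → spliced v ≡ h v
    spliced-on {v} on rewrite dec-true (onWalk? v) on = refl

    spliced-off : ∀ {v} → ¬ OnWalk v → spliced v ≡ m v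
    spliced-off {v} off rewrite dec-false (onWalk? v) off = refl

    off-walks⇒∉A : ∀ {v} → ¬ OnWalk v → ∀ {p} → ¬ T (inA[ p ] v)
    off-walks⇒∉A off av with inA⁻ av
    ... | k , refl , _ = off (k , head∈ (walk-trail k))

    spliced-matching : IsPerfectMatchingOf G (vertsH a inK) spliced
    spliced-matching = record { covers = covers ; within = within ; edge = edge ; involutive = involutive }
      where
        covers : ∀ {v} → T (vertsH a inK v) → ∃ λ u → spliced v ≡ just u
        covers {v} hv with onWalk? v
        ... | yes on = MH.covers hv
        ... | no off = MK.covers (T-not⁺ (off-walks⇒∉A off))
        within : ∀ {v u} → spliced v ≡ just u → T (vertsH a inK v)
        within {v} e with onWalk? v
        ... | yes on = MH.within e
        ... | no off = T-not⁺ (off-walks⇒∉A off)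
        edge : ∀ {v u} → spliced v ≡ just u → T (adj v u)
        edge {v} e with onWalk? v
        ... | yes on = MH.edge e
        ... | no off = MK.edge e
        involutive : ∀ {v u} → spliced v ≡ just u → spliced u ≡ just v
        involutive {v} e with onWalk? v
        ... | yes (k , v∈) = trans (spliced-on (k , walk-closed {s = true} v∈ e)) (MH.involutive e)
        ... | no off =
          trans (spliced-off λ (k , u∈) → off (k , walk-closed {s = false} u∈ (MK.involutive e))) (MK.involutive e)

    off-walks⇒m≡h : (∀ M → M ≡ MH) → ∀ {v} → ¬ OnWalk v → m v ≡ h v
    off-walks⇒m≡h unique {v} off = begin
      m v                      ≡⟨ sym (spliced-off off) ⟩
      spliced v                ≡⟨ sym (lookup∘tabulate spliced v) ⟩
      lookup (proj₁ MH′) v     ≡⟨ cong (λ M → lookup (proj₁ M) v) (unique MH′) ⟩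
      h v                      ∎
      where
        open ≡-Reasoning
        MH′ : PerfectMatching G (vertsH a inK)
        MH′ = perfectMatching G spliced-matching

  -- From a nest to a perfect matching of K

  h-matched⇒AH : ∀ {k y} → h (a k) ≡ just y → T (inAH a inK (a k))
  h-matched⇒AH {k} hk with inK k in K
  ... | true = contradiction (trans (sym hk) (h-unmatched-at-AK (subst T (sym K) _))) λ ()
  ... | false = inA⁺ (subst (T ∘ not) (sym K) _)

  colour-at-head : ∀ {i xs w te} t → AltTrail t (a i) xs w te → a i ≢ w
                 → (T (inAH a inK (a i)) → t ≡ true) → t ≡ not (inK i)
  colour-at-head {i} true p ai≢w _ with inK i in K
  ... | true =
    contradiction (trans (sym (h-unmatched-at-AK (subst T (sym K) _))) (proj₂ (MH-at-open-head p ai≢w))) λ ()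
  ... | false = refl
  colour-at-head {i} false _ _ starts-MH with inK i in K
  ... | true = refl
  ... | false = starts-MH (inA⁺ (subst (T ∘ not) (sym K) _))

  colour-at-last : ∀ {j t x xs} te → AltTrail t x xs (a j) te → x ≢ a j
                 → (T (inAH a inK (a j)) → te ≡ false) → te ≡ inK j
  colour-at-last {j} true _ _ ends-MH with inK j in K
  ... | true = refl
  ... | false = ends-MH (inA⁺ (subst (T ∘ not) (sym K) _))
  colour-at-last {j} false p x≢aj _ with inK j in K
  ... | true =
    contradiction (trans (sym (h-unmatched-at-AK (subst T (sym K) _))) (proj₂ (MH-at-open-last p x≢aj))) λ ()
  ... | false = refl

  module FromNest (ν : Vec (List (Fin N)) n) (valid : T (isNest G a inK MH ν ∧ nonIntersecting G a inK MH ν)) where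

    path : Fin n → List (Fin N)
    path = lookup ν

    private
      nested : T (isNest G a inK MH ν)
      nested = proj₁ (T-∧⁻ {isNest G a inK MH ν} valid)

    entry : ∀ i → Entry i (path i)
    entry = entryOK⁻ ν ∘ allF⁻ (proj₁ (T-∧⁻ {allF (entryOK G a inK MH ν)} nested))

    endpoint : ∀ k → ∃ λ i → T (endpointOf G a inK MH ν k i)
    endpoint = countF-one⁻ ∘ allF⁻ (proj₂ (T-∧⁻ {allF (entryOK G a inK MH ν)} nested))

    paths-disjoint : ∀ {i j x} → x ∈ path i → x ∈ path j → i ≡ j
    paths-disjoint = nonIntersecting⁻ ν (proj₂ (T-∧⁻ {isNest G a inK MH ν} valid))

    record Route (i : Fin n) : Set where
      field
        far : Fin n
        i<far : T (i <F far)
        altPath : AltPath (a i) (a far) (path i)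
      open AltPath altPath public

      ends-differ : a i ≢ a far
      ends-differ ai≡af = <F-irrefl {i = i} (subst (λ j → T (i <F j)) (sym (a-injective _ _ ai≡af)) i<far)

    route : ∀ {i x} → x ∈ path i → Route i
    route {i} x∈ with entry i
    ... | inj₁ empty = contradiction empty (∈⇒nonempty x∈)
    ... | inj₂ (j , i<j , P) = record { far = j ; i<far = i<j ; altPath = P }

    a-endpoint : ∀ k → ∃ λ i → Σ (Route i) λ R → a k ≡ a i ⊎ a k ≡ a (Route.far R)
    a-endpoint k with endpoint k
    ... | i , e with endpointOf⁻ ν e
    ...   | nonempty , which with entry i
    ...     | inj₁ empty = contradiction empty nonempty
    ...     | inj₂ (j , i<j , P) =
      i , R , Sum.map (cong a ∘ sym) (altTrail-endsAt⁻ (AltPath.trail P)) which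
      where
        R : Route i
        R = record { far = j ; i<far = i<j ; altPath = P }

    route-endpoint∈ : ∀ {l x} (R : Route l) → x ≡ a l ⊎ x ≡ a (Route.far R) → x ∈ path l
    route-endpoint∈ R (inj₁ refl) = altTrail-head∈ (Route.trail R)
    route-endpoint∈ R (inj₂ refl) = altTrail-last∈ (Route.trail R)

    route-endpoint-AH : ∀ {l x} (R : Route l) → x ≡ a l ⊎ x ≡ a (Route.far R) → T (inAH a inK x)
                      → pathPartner (path l) x ≡ nothing
    route-endpoint-AH R (inj₁ refl) ah =
      pathPartner-at-MH-head (subst (λ c → AltTrail c _ _ _ _) (Route.starts-in-MH R ah) (Route.trail R)) (Route.unique R)
    route-endpoint-AH R (inj₂ refl) ah =
      pathPartner-at-MH-last (subst (AltTrail _ _ _ _) (Route.ends-in-MH R ah) (Route.trail R)) (Route.unique R)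

    a-on-path : ∀ k → ∃ λ i → a k ∈ path i
    a-on-path k with a-endpoint k
    ... | i , R , at-end = i , route-endpoint∈ R at-end

    off-paths⇒∉A : ∀ {v} → (∀ i → v ∉ path i) → ∀ {p} → ¬ T (inA[ p ] v)
    off-paths⇒∉A off av with inA⁻ av
    ... | k , refl , _ = case a-on-path k of λ where (i , ak∈) → off i ak∈

    -- A vertex of A_H lies on a path only as an endpoint, where its M_H-edge is used.
    pathPartner-at-AH : ∀ {i x} → x ∈ path i → T (inAH a inK x) → pathPartner (path i) x ≡ nothing
    pathPartner-at-AH {i} x∈ ah with inA⁻ ah
    ... | k , refl , _ with a-endpoint k
    ...   | l , R , at-end with paths-disjoint (route-endpoint∈ R at-end) x∈
    ...     | refl = route-endpoint-AH R at-end ah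

    pathPartner-undefined⇒AH : ∀ {i x} → x ∈ path i → pathPartner (path i) x ≡ nothing → T (inAH a inK x)
    pathPartner-undefined⇒AH x∈ pp with route x∈
    ... | R with pathPartner-undefined (Route.trail R) (Route.unique R) x∈ pp
    ...   | inj₁ (refl , starts-MH) =
      h-matched⇒AH (proj₂ (MH-at-open-head (subst (λ c → AltTrail c _ _ _ _) starts-MH (Route.trail R))
                                          (Route.ends-differ R)))
    ...   | inj₂ (refl , ends-MH) =
      h-matched⇒AH (proj₂ (MH-at-open-last (subst (AltTrail _ _ _ _) ends-MH (Route.trail R)) (Route.ends-differ R)))

    MH-partner-on-path : ∀ {i x y} → x ∈ path i → h x ≡ just y → y ∈ path i
    MH-partner-on-path x∈ hx with route x∈
    ... | R = MH-partner∈ (Route.trail R) x∈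
                (λ { refl → Route.starts-in-MH R (h-matched⇒AH hx) })
                (λ { refl → Route.ends-in-MH R (h-matched⇒AH hx) }) hx

    OnPath : Fin N → Set
    OnPath v = ∃ λ i → v ∈ path i

    onPath? : ∀ v → Dec (OnPath v)
    onPath? v = any? (λ i → v ∈? path i)
      where open import Data.List.Membership.DecPropositional (_≟_ {N}) using (_∈?_)

    switch : ∀ {v} → Dec (OnPath v) → Maybe (Fin N)
    switch {v} (yes (i , _)) = pathPartner (path i) v
    switch {v} (no _) = h v

    -- M_K is M_H with the edges of the paths switched.
    μ : Fin N → Maybe (Fin N)
    μ v = switch (onPath? v)

    μ-on-path : ∀ {i v} → v ∈ path i → μ v ≡ pathPartner (path i) v
    μ-on-path {i} {v} v∈ = on (onPath? v)
      where
        on : (d : Dec (OnPath v)) → switch d ≡ pathPartner (path i) v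
        on (yes (j , v∈j)) = cong (λ l → pathPartner (path l) v) (paths-disjoint v∈j v∈)
        on (no off) = contradiction (i , v∈) off

    μ-off-paths : ∀ {v} → (∀ i → v ∉ path i) → μ v ≡ h v
    μ-off-paths {v} off = off′ (onPath? v)
      where
        off′ : (d : Dec (OnPath v)) → switch d ≡ h v
        off′ (yes (i , v∈)) = contradiction v∈ (off i)
        off′ (no _) = refl

    on-or-off-paths : ∀ v → OnPath v ⊎ (∀ i → v ∉ path i)
    on-or-off-paths v with onPath? v
    ... | yes on = inj₁ on
    ... | no off = inj₂ λ i v∈ → off (i , v∈)

    μ-matching : IsPerfectMatchingOf G (vertsK a inK) μ
    μ-matching = record { covers = covers ; within = within ; edge = edge ; involutive = involutive }
      where
        covers : ∀ {v} → T (vertsK a inK v) → ∃ λ u → μ v ≡ just u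
        covers {v} kv with on-or-off-paths v
        ... | inj₁ (i , v∈) with pathPartner (path i) v in pp
        ...   | just u = u , trans (μ-on-path v∈) pp
        ...   | nothing = contradiction (pathPartner-undefined⇒AH v∈ pp) (T-not⁻ kv)
        covers {v} kv | inj₂ off = case MH.covers (T-not⁺ (off-paths⇒∉A off)) of λ where
          (u , hv) → u , trans (μ-off-paths off) hv
        within : ∀ {v u} → μ v ≡ just u → T (vertsK a inK v)
        within {v} e with on-or-off-paths v
        ... | inj₁ (i , v∈) = T-not⁺ λ ah →
          contradiction (trans (sym (pathPartner-at-AH v∈ ah)) (trans (sym (μ-on-path v∈)) e)) λ ()
        ... | inj₂ off = T-not⁺ (off-paths⇒∉A off)
        edge : ∀ {v u} → μ v ≡ just u → T (adj v u)
        edge {v} e with on-or-off-paths v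
        ... | inj₁ (i , v∈) = pathPartner-adj (Route.trail (route v∈)) (trans (sym (μ-on-path v∈)) e)
        ... | inj₂ off = MH.edge (trans (sym (μ-off-paths off)) e)
        involutive : ∀ {v u} → μ v ≡ just u → μ u ≡ just v
        involutive {v} {u} e with on-or-off-paths v
        ... | inj₁ (i , v∈) =
          trans (μ-on-path (proj₂ (pathPartner-∈ (path i) pp))) (pathPartner-symmetric (Route.trail R) (Route.unique R) pp)
          where
            R : Route i
            R = route v∈
            pp : pathPartner (path i) v ≡ just u
            pp = trans (sym (μ-on-path v∈)) e
        ... | inj₂ off = trans (μ-off-paths u-off) (MH.involutive hv)
          where
            hv : h v ≡ just u
            hv = trans (sym (μ-off-paths off)) e
            u-off : ∀ i → u ∉ path i
            u-off i u∈ = off i (MH-partner-on-path u∈ (MH.involutive hv))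

    MK : PerfectMatching G (vertsK a inK)
    MK = perfectMatching G μ-matching

-- The two constructions are mutually inverse

Σ-T-≡ : ∀ {A : Set} {B : A → Bool} {x y : A} {p : T (B x)} {q : T (B y)}
      → x ≡ y → _≡_ {A = Σ A (T ∘ B)} (x , p) (y , q)
Σ-T-≡ {x = x} {p = p} {q} refl = cong (x ,_) (T-irrelevant p q)

module RoundTrips {N n : ℕ} (G : Graph N) (a : Fin n → Fin N) (inK : Fin n → Bool)
  (a-injective : ∀ i j → a i ≡ a j → i ≡ j) (MH : PerfectMatching G (vertsH a inK)) where

  open Correspondence G a inK a-injective MH

  module _ (ν : Vec (List (Fin N)) n) (valid : T (isNest G a inK MH ν ∧ nonIntersecting G a inK MH ν)) where

    open FromNest ν valid
    module Back = FromMatching MK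

    route-walkFrom : ∀ {i} (R : Route i) → Back.WalkFrom i (path i)
    route-walkFrom {i} R = record
      { far = far
      ; trail = subst₂ (λ c e → Back.Trail c (a i) (path i) (a far) e) head-colour last-colour coloured }
      where
        open Route R
        head-colour : colour ≡ not (inK i)
        head-colour = colour-at-head colour trail ends-differ starts-in-MH
        last-colour : endColour ≡ inK far
        last-colour = colour-at-last endColour trail ends-differ ends-in-MH
        coloured : Back.Trail colour (a i) (path i) (a far) endColour
        coloured = altTrail⇒colouredTrail trail unique λ v∈ _ → trans (lookup∘tabulate μ _) (μ-on-path v∈)

    route-walk : ∀ {i} (R : Route i) → Back.walk i ≡ path i × Back.opposite i ≡ Route.far R
    route-walk {i} R = walk≡path , Back.walkFrom-far found (route-walkFrom R) walk≡path
      where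
        found : Back.WalkFrom i (Back.walk i)
        found = Back.walk-walkFrom i
        walk≡path : Back.walk i ≡ path i
        walk≡path = Back.walkFrom-deterministic found (route-walkFrom R)

    nestPath≡path : ∀ i → Back.nestPath i ≡ path i
    nestPath≡path i with entry i
    ... | inj₂ (j , i<j , P) with route-walk (record { far = j ; i<far = i<j ; altPath = P }) | Back.nestPath-cases i
    ...   | walk≡path , _ | inj₁ (_ , stored) = trans stored walk≡path
    ...   | _ , refl | inj₂ (i≮j , _) = contradiction i<j i≮j
    nestPath≡path i | inj₁ empty with a-endpoint i
    ... | l , R , inj₁ ai≡al = contradiction empty
      (∈⇒nonempty (subst (λ k → a i ∈ path k) (a-injective l i (sym ai≡al)) (route-endpoint∈ R (inj₁ ai≡al))))
    ... | l , R , inj₂ ai≡af with Back.nestPath-cases i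
    ...   | inj₂ (_ , unstored) = trans unstored (sym empty)
    ...   | inj₁ (i<i′ , _) = contradiction l<i (<F-asym {i = i} (subst (λ k → T (i <F k)) opposite-i i<i′))
      where
        far≡i : Route.far R ≡ i
        far≡i = a-injective _ _ (sym ai≡af)
        opposite-i : Back.opposite i ≡ l
        opposite-i =
          trans (cong Back.opposite (trans (sym far≡i) (sym (proj₂ (route-walk R))))) (Back.opposite-involutive l)
        l<i : T (l <F i)
        l<i = subst (λ k → T (l <F k)) far≡i (Route.i<far R)

    nest-roundtrip : Back.nest ≡ ν
    nest-roundtrip = trans (tabulate-cong nestPath≡path) (tabulate∘lookup ν)

  module _ (MK : PerfectMatching G (vertsK a inK)) (unique-MH : ∀ M → M ≡ MH) where

    open FromMatching MK
    module Forth = FromNest nest nest-valid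

    stored-path : ∀ {i v} → v ∈ Forth.path i → Forth.path i ≡ walk i
    stored-path {i} v∈ = trans (lookup∘tabulate nestPath i)
      (proj₂ (nestPath-nonempty (∈⇒nonempty (subst (_ ∈_) (lookup∘tabulate nestPath i) v∈))))

    walk-is-stored : ∀ {k v} → v ∈ walk k → Forth.OnPath v
    walk-is-stored {k} v∈ with nestPath-cases k
    ... | inj₁ (_ , stored) = k , subst (_ ∈_) (sym (trans (lookup∘tabulate nestPath k) stored)) v∈
    ... | inj₂ (k≮k′ , _) =
      opposite k , subst (_ ∈_) (sym (trans (lookup∘tabulate nestPath (opposite k)) reversed)) (reverse⁺ v∈)
      where
        reversed : nestPath (opposite k) ≡ reverse (walk k)
        reversed = trans (nestPath-opposite k≮k′) (walk-opposite k)

    μ≡m : ∀ v → Forth.μ v ≡ m v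
    μ≡m v with Forth.on-or-off-paths v
    ... | inj₁ (i , v∈) = trans (Forth.μ-on-path v∈)
      (trans (cong (λ l → pathPartner l v) (stored-path v∈)) (walk-pathPartner (subst (v ∈_) (stored-path v∈) v∈)))
    ... | inj₂ off = trans (Forth.μ-off-paths off) (sym (off-walks⇒m≡h unique-MH off-walks))
      where
        off-walks : ¬ OnWalk v
        off-walks (k , v∈) = case walk-is-stored v∈ of λ where (i , v∈i) → off i v∈i

    matching-roundtrip : Forth.MK ≡ MK
    matching-roundtrip = Σ-T-≡ (trans (tabulate-cong μ≡m) (tabulate∘lookup (proj₁ MK)))

lemma3p3 : ∀ {N n : ℕ} (G : Graph N) (a : Fin n → Fin N) (inK : Fin n → Bool)
           → 2 ∣ n
           → (∀ i j → a i ≡ a j → i ≡ j)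
           → PlaneWithFaceOrder G a
           → (MH : PerfectMatching G (vertsH a inK))
           → (∀ M → M ≡ MH)
           → NonIntersectingNest G a inK MH ↔ PerfectMatching G (vertsK a inK)
lemma3p3 G a inK _ a-injective _ MH unique-MH =
  mk↔ₛ′ to from (λ MK → matching-roundtrip MK unique-MH) (λ (ν , valid) → Σ-T-≡ (nest-roundtrip ν valid))
  where
    open Correspondence G a inK a-injective MH
    open RoundTrips G a inK a-injective MH
    to : NonIntersectingNest G a inK MH → PerfectMatching G (vertsK a inK)
    to (ν , valid) = FromNest.MK ν valid
    from : PerfectMatching G (vertsK a inK) → NonIntersectingNest G a inK MH
    from MK = FromMatching.nest MK , FromMatching.nest-valid MK
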